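{- Let $S\subset\mathbb{Z}_{>0}$ be a finite nonempty set of positive integers and $m=\max(S)$. Then for every integer $n\ge m$, \[ D_S(n,q)=\sum_{k=0}^m a_k(S;q)\begin{bmatrix} n-m\\ k\end{bmatrix}_q, \] where $a_0(S;q)=0$ and for $k\ge 1$, \[ a_k(S;q)=\sum_{\substack{\pi\in A(S;m+k)\\ [m+1,m+k]\subset\{\pi_1,\ldots,\pi_m\}}} q^{\ell(\pi)} \in \mathbb{R}_{\geq 0}[q]. \]
   Context: For $\pi=\pi_1\cdots\pi_n\in\mathfrak{S}_n$ in one-line notation, $\mathrm{Des}(\pi)=\{i\in[n-1]: \pi_i>\pi_{i+1}\}$ and $\ell(\pi)=|\{(i,j): 1\le i<j\le n,\ \pi_i>\pi_j\}|$ is the number of inversions. $A(S;n)=\{\pi\in\mathfrak{S}_n:\mathrm{Des}(\pi)=S\}$ and $D_S(n,q)=\sum_{\pi\in A(S;n)}q^{\ell(\pi)}$. $[a,b]$ denotes $\{a,a+1,\ldots,b\}$. $[k]_q=1+q+\cdots+q^{k-1}$, $[k]!_q=[1]_q\cdots[k]_q$, and $\begin{bmatrix} n\\ k\end{bmatrix}_q=\frac{[n]!_q}{[n-k]!_q[k]!_q}$ for $0\le k\le n$, and $0$ if $k>n\ge 0$. -}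

module Defs where

open import Data.Nat using (ℕ; zero; suc; _+_; _*_; _∸_; _^_; _⊔_; _≤_; _≡ᵇ_; _<ᵇ_; _≤ᵇ_; NonZero)
open import Data.Nat.Properties using (m*n≢0)
open import Data.Nat.DivMod using (_/_)
open import Data.Bool using (Bool; true; false; if_then_else_; _∧_)
open import Data.List using (List; []; _∷_; map; concatMap; upTo; take; foldr)
open import Data.Nat.ListAction using (sum)
open import Data.Bool.ListAction using (all; any)

_∈ᵇ_ : ℕ → List ℕ → Bool
x ∈ᵇ xs = any (λ y → y ≡ᵇ x) xs

-- [a, b] = {a, a+1, ..., b}  (empty if b < a)
interval : ℕ → ℕ → List ℕ
interval a b = map (λ i → a + i) (upTo (suc b ∸ a))

maxL : List ℕ → ℕ
maxL = foldr _⊔_ 0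

-- Permutations of [n] in one-line notation, as lists π₁ ⋯ πₙ

words : ℕ → List ℕ → List (List ℕ)
words zero    A = [] ∷ []
words (suc n) A = concatMap (λ a → map (a ∷_) (words n A)) A

-- a word of length n over [1,n] is a permutation iff every i ∈ [1,n] occurs
isPermᵇ : ℕ → List ℕ → Bool
isPermᵇ n w = all (λ i → i ∈ᵇ w) (interval 1 n)

perms : ℕ → List (List ℕ)
perms n = Data.List.filterᵇ (isPermᵇ n) (words n (interval 1 n))
  where import Data.List

-- descent set Des(π) = { i : πᵢ > πᵢ₊₁ } (1-based positions)
desFrom : ℕ → List ℕ → List ℕ
desFrom i []           = []
desFrom i (x ∷ [])     = []
desFrom i (x ∷ y ∷ ys) =
  if y <ᵇ x then i ∷ desFrom (suc i) (y ∷ ys) else desFrom (suc i) (y ∷ ys)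

Des : List ℕ → List ℕ
Des = desFrom 1

DesEqᵇ : List ℕ → List ℕ → Bool
DesEqᵇ π S = all (λ i → i ∈ᵇ S) (Des π) ∧ all (λ s → s ∈ᵇ Des π) S

inv : List ℕ → ℕ
inv []       = 0
inv (x ∷ xs) = sum (map (λ y → if y <ᵇ x then 1 else 0) xs) + inv xs

-- Polynomials in q are handled through their values at every q ∈ ℕ.

D : List ℕ → ℕ → ℕ → ℕ
D S n q = sum (map (λ π → if DesEqᵇ π S then q ^ inv π else 0) (perms n))

a : List ℕ → ℕ → ℕ → ℕ
a S zero    q = 0
a S (suc j) q =
  sum (map (λ π → if DesEqᵇ π S ∧ all (λ v → v ∈ᵇ take m π) (interval (suc m) (m + k))
                  then q ^ inv π else 0)
           (perms (m + k)))
  where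
    m = maxL S
    k = suc j

qint : ℕ → ℕ → ℕ
qint q k = sum (map (q ^_) (upTo k))

qfact : ℕ → ℕ → ℕ
qfact q zero    = 1
qfact q (suc k) = qint q (suc k) * qfact q k

qfact-nonZero : ∀ q k → NonZero (qfact q k)
qfact-nonZero q zero    = _
qfact-nonZero q (suc k) = m*n≢0 (qint q (suc k)) (qfact q k) {{_}} {{qfact-nonZero q k}}

qbinom : ℕ → ℕ → ℕ → ℕ
qbinom q n k =
  if k ≤ᵇ n
  then (qfact q n / (qfact q (n ∸ k) * qfact q k))
         {{m*n≢0 (qfact q (n ∸ k)) (qfact q k) {{qfact-nonZero q (n ∸ k)}} {{qfact-nonZero q k}}}}
  else 0

-- A permutation in A(S; n) with n ≥ m = max S has a descent at m and none after it, so it is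
-- determined by its first m letters: the remaining letters follow in increasing order, and the
-- only further condition is that one of them is smaller than the m-th letter. Let Dtop L k be
-- the q-count of those π ∈ A(S; L + k) whose first m letters include the k largest values
-- L+1, …, L+k; then D_S(n) = Dtop n 0 and a_k = Dtop m k. For L ≥ m, sorting permutations by
-- whether L+1 is among the first m letters gives the q-Pascal recurrence
-- Dtop (L+1) k = q^k Dtop L k + Dtop L (k+1): when L+1 lies in the increasing tail, the k larger
-- values all precede it, and deleting it relabels the rest. Iterating the recurrence n − m times
-- gives Dtop n 0 = Σ_j [n−m choose j]_q Dtop m j, and Dtop m j = 0 for j > m.

{-# OPTIONS --safe #-}
module Submission where

open import Defs
open import Algebra.Bundles using (CommutativeMonoid)
open import Data.Bool using (Bool; true; false; if_then_else_; _∧_; _∨_; not; T)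
open import Data.Bool.ListAction using (all; any; and; or)
open import Data.Bool.Properties using (∧-assoc; ∧-identityʳ; ∧-zeroʳ; ∨-identityʳ; ∨-zeroʳ; ∧-commutativeMonoid)
open import Data.Empty using (⊥; ⊥-elim)
open import Data.List using (List; []; _∷_; _++_; map; concatMap; filter; filterᵇ; length; take; upTo; applyUpTo)
open import Data.List.Properties
  using (filter-accept; filter-reject; filter-all; filter-++; map-applyUpTo; map-∘; map-++; length-take)
open import Data.List.Membership.Propositional using (_∈_; _∉_)
open import Data.List.Membership.Propositional.Properties using (∈-filter⁺; ∈-filter⁻; ∈-map⁺; ∈-map⁻; ∈-++⁺ʳ)
open import Data.List.Relation.Unary.All as All using (All; []; _∷_)
open import Data.List.Relation.Unary.AllPairs using (AllPairs; []; _∷_)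
import Data.List.Relation.Unary.AllPairs.Properties as AllPairs
open import Data.List.Relation.Unary.Any using (here; there)
open import Data.Nat using (ℕ; zero; suc; _+_; _*_; _^_; _∸_; _<_; _≤_; _≡ᵇ_; _<ᵇ_; _≤ᵇ_; _≟_; _<?_; z≤n; s≤s; NonZero)
open import Data.Nat.DivMod using (_/_; m*n/n≡m)
open import Data.Nat.ListAction using (sum)
open import Data.Nat.Properties
open import Data.Nat.Tactic.RingSolver using (solve-∀)
open import Data.Product using (∃; _×_; _,_; proj₁; proj₂)
open import Data.Sum using (inj₁; inj₂)
open import Data.Unit using (tt)
open import Function using (_∘_; id)
open import Relation.Binary.Definitions using (tri<; tri≈; tri>)
open import Relation.Binary.PropositionalEquality
open import Relation.Nullary using (¬_; Reflects; ofʸ; ofⁿ; proof; ¬?; yes; no)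
open import Relation.Nullary.Decidable using (T?; Dec; _because_; dec-true; dec-false; does-≡; map′; _×-dec_)

open import Algebra.Properties.CommutativeSemigroup +-commutativeSemigroup using (interchange; x∙yz≈y∙xz)
import Algebra.Properties.CommutativeSemigroup (CommutativeMonoid.commutativeSemigroup ∧-commutativeMonoid) as ∧

private
  variable
    A B : Set

∑ : (A → ℕ) → List A → ℕ
∑ f xs = sum (map f xs)

infix 5 ∑
syntax ∑ (λ x → e) xs = ∑[ x ∈ xs ] e

∑-cong : ∀ {f g : A → ℕ} xs → (∀ {x} → x ∈ xs → f x ≡ g x) → ∑ f xs ≡ ∑ g xs
∑-cong []       f≗g = refl
∑-cong (x ∷ xs) f≗g = cong₂ _+_ (f≗g (here refl)) (∑-cong xs (f≗g ∘ there))

∑-vanishes : ∀ {f : A → ℕ} xs → (∀ {x} → x ∈ xs → f x ≡ 0) → ∑ f xs ≡ 0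
∑-vanishes []       f≗0 = refl
∑-vanishes (x ∷ xs) f≗0 = cong₂ _+_ (f≗0 (here refl)) (∑-vanishes xs (f≗0 ∘ there))

∑-distrib-+ : ∀ (f g : A → ℕ) xs → ∑[ x ∈ xs ] (f x + g x) ≡ ∑ f xs + ∑ g xs
∑-distrib-+ f g []       = refl
∑-distrib-+ f g (x ∷ xs) =
  trans (cong (f x + g x +_) (∑-distrib-+ f g xs)) (interchange (f x) (g x) (∑ f xs) (∑ g xs))

∑-*ˡ : ∀ c (f : A → ℕ) xs → ∑[ x ∈ xs ] (c * f x) ≡ c * ∑ f xs
∑-*ˡ c f []       = sym (*-zeroʳ c)
∑-*ˡ c f (x ∷ xs) = trans (cong (c * f x +_) (∑-*ˡ c f xs)) (sym (*-distribˡ-+ c (f x) (∑ f xs)))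

∑-filterᵇ : ∀ (P : A → Bool) (f : A → ℕ) xs →
            ∑ f (filterᵇ P xs) ≡ ∑[ x ∈ xs ] (if P x then f x else 0)
∑-filterᵇ P f []       = refl
∑-filterᵇ P f (x ∷ xs) with P x
... | true  = cong (f x +_) (∑-filterᵇ P f xs)
... | false = ∑-filterᵇ P f xs

∑-++ : ∀ (f : A → ℕ) xs ys → ∑ f (xs ++ ys) ≡ ∑ f xs + ∑ f ys
∑-++ f []       ys = refl
∑-++ f (x ∷ xs) ys = trans (cong (f x +_) (∑-++ f xs ys)) (sym (+-assoc (f x) (∑ f xs) (∑ f ys)))

∑-map : ∀ (f : B → ℕ) (g : A → B) xs → ∑ f (map g xs) ≡ ∑ (f ∘ g) xs
∑-map f g []       = refl
∑-map f g (x ∷ xs) = cong (f (g x) +_) (∑-map f g xs)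

∑-concatMap : ∀ (f : B → ℕ) (g : A → List B) xs →
              ∑ f (concatMap g xs) ≡ ∑[ x ∈ xs ] ∑ f (g x)
∑-concatMap f g []       = refl
∑-concatMap f g (x ∷ xs) = trans (∑-++ f (g x) (concatMap g xs)) (cong (∑ f (g x) +_) (∑-concatMap f g xs))

if-*-zero : ∀ b c → (if b then c * 0 else 0) ≡ 0
if-*-zero true  c = *-zeroʳ c
if-*-zero false c = refl

if-*ʳ : ∀ b c x → (if b then c * x else 0) ≡ c * (if b then x else 0)
if-*ʳ true  c x = refl
if-*ʳ false c x = sym (*-zeroʳ c)

∑< : ℕ → (ℕ → ℕ) → ℕ
∑< zero    f = 0
∑< (suc L) f = f 0 + ∑< L (f ∘ suc)

infix 5 ∑<
syntax ∑< L (λ j → e) = ∑[ j < L ] e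

∑<-cong : ∀ L {f g : ℕ → ℕ} → (∀ j → f j ≡ g j) → ∑< L f ≡ ∑< L g
∑<-cong zero    f≗g = refl
∑<-cong (suc L) f≗g = cong₂ _+_ (f≗g 0) (∑<-cong L (f≗g ∘ suc))

∑<-vanishes : ∀ L {f : ℕ → ℕ} → (∀ j → f j ≡ 0) → ∑< L f ≡ 0
∑<-vanishes zero    f≗0 = refl
∑<-vanishes (suc L) f≗0 = cong₂ _+_ (f≗0 0) (∑<-vanishes L (f≗0 ∘ suc))

∑<-distrib-+ : ∀ L (f g : ℕ → ℕ) → ∑[ j < L ] (f j + g j) ≡ ∑< L f + ∑< L g
∑<-distrib-+ zero    f g = refl
∑<-distrib-+ (suc L) f g =
  trans (cong (f 0 + g 0 +_) (∑<-distrib-+ L (f ∘ suc) (g ∘ suc))) (interchange (f 0) (g 0) _ _)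

∑<-*ˡ : ∀ L c (f : ℕ → ℕ) → ∑[ j < L ] (c * f j) ≡ c * ∑< L f
∑<-*ˡ zero    c f = sym (*-zeroʳ c)
∑<-*ˡ (suc L) c f = trans (cong (c * f 0 +_) (∑<-*ˡ L c (f ∘ suc))) (sym (*-distribˡ-+ c (f 0) _))

∑<-+ : ∀ L₁ L₂ (f : ℕ → ℕ) → ∑< (L₁ + L₂) f ≡ ∑< L₁ f + (∑[ j < L₂ ] f (L₁ + j))
∑<-+ zero     L₂ f = refl
∑<-+ (suc L₁) L₂ f = trans (cong (f 0 +_) (∑<-+ L₁ L₂ (f ∘ suc))) (sym (+-assoc (f 0) _ _))

∑-upTo : ∀ L (f : ℕ → ℕ) → ∑ f (upTo L) ≡ ∑< L f
∑-upTo L f = ∑-applyUpTo L id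
  where
  ∑-applyUpTo : ∀ L g → ∑ f (applyUpTo g L) ≡ ∑< L (f ∘ g)
  ∑-applyUpTo zero    g = refl
  ∑-applyUpTo (suc L) g = cong (f (g 0) +_) (∑-applyUpTo L (g ∘ suc))

≡ᵇ-reflects-≡ : ∀ m n → Reflects (m ≡ n) (m ≡ᵇ n)
≡ᵇ-reflects-≡ m n = proof (m ≟ n)

≡ᵇ-refl : ∀ n → (n ≡ᵇ n) ≡ true
≡ᵇ-refl n = dec-true (n ≟ n) refl

≡ᵇ-sym : ∀ m n → (m ≡ᵇ n) ≡ (n ≡ᵇ m)
≡ᵇ-sym zero    zero    = refl
≡ᵇ-sym zero    (suc n) = refl
≡ᵇ-sym (suc m) zero    = refl
≡ᵇ-sym (suc m) (suc n) = ≡ᵇ-sym m n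

<ᵇ-irrefl : ∀ n → (n <ᵇ n) ≡ false
<ᵇ-irrefl n = dec-false (n <? n) (n≮n n)

∈ᵇ-reflects-∈ : ∀ x xs → Reflects (x ∈ xs) (x ∈ᵇ xs)
∈ᵇ-reflects-∈ x []       = ofⁿ λ ()
∈ᵇ-reflects-∈ x (y ∷ xs) with y ≡ᵇ x | ≡ᵇ-reflects-≡ y x
... | true  | ofʸ refl = ofʸ (here refl)
... | false | ofⁿ y≢x  with x ∈ᵇ xs | ∈ᵇ-reflects-∈ x xs
...   | true  | ofʸ x∈xs = ofʸ (there x∈xs)
...   | false | ofⁿ x∉xs = ofⁿ λ { (here refl) → y≢x refl ; (there x∈xs) → x∉xs x∈xs }

_∈ᵇ?_ : ∀ x xs → Dec (x ∈ xs)
x ∈ᵇ? xs = (x ∈ᵇ xs) because ∈ᵇ-reflects-∈ x xs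

remove : ℕ → List ℕ → List ℕ
remove a = filter (¬? ∘ (_≟ a))

Increasing : List ℕ → Set
Increasing = AllPairs _<_

module _ {a : ℕ} where

  remove-∷-≢ : ∀ {x} xs → x ≢ a → remove a (x ∷ xs) ≡ x ∷ remove a xs
  remove-∷-≢ xs = filter-accept (¬? ∘ (_≟ a))

  remove-∷-≡ : ∀ xs → remove a (a ∷ xs) ≡ remove a xs
  remove-∷-≡ xs = filter-reject (¬? ∘ (_≟ a)) (λ a≢a → a≢a refl)

  remove-∉ : ∀ {xs} → a ∉ xs → remove a xs ≡ xs
  remove-∉ a∉xs = filter-all (¬? ∘ (_≟ a)) (All.tabulate λ { x∈xs refl → a∉xs x∈xs })

  ∈-remove⁺ : ∀ {x xs} → x ∈ xs → x ≢ a → x ∈ remove a xs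
  ∈-remove⁺ = ∈-filter⁺ (¬? ∘ (_≟ a))

  ∈-remove⁻ : ∀ xs {x} → x ∈ remove a xs → x ∈ xs × x ≢ a
  ∈-remove⁻ xs = ∈-filter⁻ (¬? ∘ (_≟ a)) {xs = xs}

  remove-head : ∀ {xs} → All (a <_) xs → remove a (a ∷ xs) ≡ xs
  remove-head a<xs = trans (remove-∷-≡ _) (remove-∉ (λ a∈xs → n≮n a (All.lookup a<xs a∈xs)))

  Increasing-remove : ∀ {xs} → Increasing xs → Increasing (remove a xs)
  Increasing-remove = AllPairs.filter⁺ (¬? ∘ (_≟ a))

∈ᵇ-remove : ∀ v a xs → (v ∈ᵇ remove a xs) ≡ (v ∈ᵇ xs) ∧ not (v ≡ᵇ a)
∈ᵇ-remove v a xs =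
  does-≡ (v ∈ᵇ? remove a xs)
         (map′ (λ (v∈xs , v≢a) → ∈-remove⁺ v∈xs v≢a) (∈-remove⁻ xs) (v ∈ᵇ? xs ×-dec ¬? (v ≟ a)))

remove-comm : ∀ a b xs → remove a (remove b xs) ≡ remove b (remove a xs)
remove-comm a b []       = refl
remove-comm a b (x ∷ xs) with x ≟ a | x ≟ b
... | yes refl | yes refl = refl
... | yes refl | no x≢b
  rewrite remove-∷-≢ xs x≢b | remove-∷-≡ {x} (remove b xs) | remove-∷-≡ {x} xs = remove-comm x b xs
... | no x≢a   | yes refl
  rewrite remove-∷-≢ xs x≢a | remove-∷-≡ {x} (remove a xs) | remove-∷-≡ {x} xs = remove-comm a x xs
... | no x≢a   | no x≢b
  rewrite remove-∷-≢ xs x≢a | remove-∷-≢ xs x≢b | remove-∷-≢ (remove a xs) x≢b | remove-∷-≢ (remove b xs) x≢a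
  = cong (x ∷_) (remove-comm a b xs)

∑-remove : ∀ (f : ℕ → ℕ) {a xs} → Increasing xs → a ∈ xs → ∑ f xs ≡ f a + ∑ f (remove a xs)
∑-remove f (a<xs ∷ _) (here refl) rewrite remove-head a<xs = refl
∑-remove f {a} {x ∷ xs} (x<xs ∷ xs↑) (there a∈xs)
  rewrite remove-∷-≢ xs (<⇒≢ (All.lookup x<xs a∈xs)) | ∑-remove f xs↑ a∈xs = x∙yz≈y∙xz (f x) (f a) _

length-remove : ∀ {a xs} → Increasing xs → a ∈ xs → length xs ≡ suc (length (remove a xs))
length-remove (a<xs ∷ _) (here refl) rewrite remove-head a<xs = refl
length-remove {a} {x ∷ xs} (x<xs ∷ xs↑) (there a∈xs)
  rewrite remove-∷-≢ xs (<⇒≢ (All.lookup x<xs a∈xs)) = cong suc (length-remove xs↑ a∈xs)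

length-remove-∈ : ∀ {a xs k} → Increasing xs → a ∈ xs → length xs ≡ suc k → length (remove a xs) ≡ k
length-remove-∈ xs↑ a∈xs |xs|≡1+k = suc-injective (trans (sym (length-remove xs↑ a∈xs)) |xs|≡1+k)

length-remove-≤ : ∀ a {xs} → Increasing xs → length xs ≤ suc (length (remove a xs))
length-remove-≤ a {xs} xs↑ with a ∈ᵇ? xs
... | yes a∈xs = ≤-reflexive (length-remove xs↑ a∈xs)
... | no  a∉xs rewrite remove-∉ a∉xs = n≤1+n _

𝟙 : Bool → ℕ
𝟙 b = if b then 1 else 0

count : (ℕ → Bool) → List ℕ → ℕ
count P xs = ∑[ y ∈ xs ] 𝟙 (P y)

count-none : ∀ (P : ℕ → Bool) xs → (∀ {x} → x ∈ xs → P x ≡ false) → count P xs ≡ 0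
count-none P xs Pxs = ∑-vanishes xs λ x∈xs → cong 𝟙 (Pxs x∈xs)

count-all : ∀ (P : ℕ → Bool) xs → (∀ {x} → x ∈ xs → P x ≡ true) → count P xs ≡ length xs
count-all P []       Pxs = refl
count-all P (x ∷ xs) Pxs rewrite Pxs (here refl) = cong suc (count-all P xs (Pxs ∘ there))

count-<ᵇ-remove : ∀ {a xs} → Increasing xs → a ∈ xs → count (_<ᵇ a) (remove a xs) ≡ count (_<ᵇ a) xs
count-<ᵇ-remove {a} {xs} xs↑ a∈xs =
  sym (trans (∑-remove (λ y → 𝟙 (y <ᵇ a)) xs↑ a∈xs) (cong (λ b → 𝟙 b + count (_<ᵇ a) (remove a xs)) (<ᵇ-irrefl a)))

module _ {P Q : A → Bool} where

  all-cong : ∀ xs → (∀ {x} → x ∈ xs → P x ≡ Q x) → all P xs ≡ all Q xs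
  all-cong []       P≗Q = refl
  all-cong (x ∷ xs) P≗Q = cong₂ _∧_ (P≗Q (here refl)) (all-cong xs (P≗Q ∘ there))

  any-cong : ∀ xs → (∀ {x} → x ∈ xs → P x ≡ Q x) → any P xs ≡ any Q xs
  any-cong []       P≗Q = refl
  any-cong (x ∷ xs) P≗Q = cong₂ _∨_ (P≗Q (here refl)) (any-cong xs (P≗Q ∘ there))

module _ {P : A → Bool} where

  all-true : ∀ xs → (∀ {x} → x ∈ xs → P x ≡ true) → all P xs ≡ true
  all-true []       _  = refl
  all-true (x ∷ xs) Pxs rewrite Pxs (here refl) = all-true xs (Pxs ∘ there)

  all-false : ∀ {x xs} → x ∈ xs → P x ≡ false → all P xs ≡ false
  all-false          (here refl)  Px≡false rewrite Px≡false = refl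
  all-false {xs = y ∷ xs} (there x∈xs) Px≡false =
    trans (cong (P y ∧_) (all-false x∈xs Px≡false)) (∧-zeroʳ (P y))

  all-sound : ∀ {x xs} → all P xs ≡ true → x ∈ xs → P x ≡ true
  all-sound {xs = y ∷ xs} all≡true x∈xs with P y in Py
  all-sound all≡true (here refl)  | true = Py
  all-sound all≡true (there x∈xs) | true = all-sound all≡true x∈xs

  any-true : ∀ {x xs} → x ∈ xs → P x ≡ true → any P xs ≡ true
  any-true          (here refl)  Px≡true rewrite Px≡true = refl
  any-true {xs = y ∷ xs} (there x∈xs) Px≡true =
    trans (cong (P y ∨_) (any-true x∈xs Px≡true)) (∨-zeroʳ (P y))

  any-false : ∀ xs → (∀ {x} → x ∈ xs → P x ≡ false) → any P xs ≡ false
  any-false []       _  = refl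
  any-false (x ∷ xs) Pxs rewrite Pxs (here refl) = any-false xs (Pxs ∘ there)

module _ (a : ℕ) (P : ℕ → Bool) where

  all-remove : ∀ xs → all (λ s → (a ≡ᵇ s) ∨ P s) xs ≡ all P (remove a xs)
  all-remove []       = refl
  all-remove (x ∷ xs) with x ≟ a
  ... | yes refl rewrite remove-∷-≡ {x} xs | ≡ᵇ-refl x = all-remove xs
  ... | no  x≢a  rewrite remove-∷-≢ xs x≢a | dec-false (a ≟ x) (x≢a ∘ sym) = cong (P x ∧_) (all-remove xs)

  all-split : ∀ xs → all P xs ≡ (not (a ∈ᵇ xs) ∨ P a) ∧ all P (remove a xs)
  all-split []       = refl
  all-split (x ∷ xs) with x ≟ a
  ... | yes refl rewrite remove-∷-≡ {x} xs | ≡ᵇ-refl x | all-split xs = absorb (P x) (not (x ∈ᵇ xs))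
    where
    absorb : ∀ p b {c} → p ∧ ((b ∨ p) ∧ c) ≡ p ∧ c
    absorb true  b = cong (_∧ _) (∨-zeroʳ b)
    absorb false b = refl
  ... | no  x≢a  rewrite remove-∷-≢ xs x≢a | dec-false (x ≟ a) x≢a | all-split xs =
    ∧.x∙yz≈y∙xz (P x) (not (a ∈ᵇ xs) ∨ P a) (all P (remove a xs))

Increasing-filterᵇ : ∀ (P : ℕ → Bool) {xs} → Increasing xs → Increasing (filterᵇ P xs)
Increasing-filterᵇ P = AllPairs.filter⁺ (T? ∘ P)

∈-filterᵇ : ∀ (P : A → Bool) {x xs} → x ∈ xs → P x ≡ true → x ∈ filterᵇ P xs
∈-filterᵇ P x∈xs Px = ∈-filter⁺ (T? ∘ P) x∈xs (subst T (sym Px) tt)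

∉-filterᵇ : ∀ (P : A → Bool) {x xs} → P x ≡ false → x ∉ filterᵇ P xs
∉-filterᵇ P {xs = xs} Px x∈ = subst T Px (proj₂ (∈-filter⁻ (T? ∘ P) {xs = xs} x∈))

remove-filterᵇ : ∀ a (P : ℕ → Bool) xs → remove a (filterᵇ P xs) ≡ filterᵇ (λ y → P y ∧ not (y ≡ᵇ a)) xs
remove-filterᵇ a P []       = refl
remove-filterᵇ a P (x ∷ xs) with P x
... | false = remove-filterᵇ a P xs
... | true with x ≟ a
...   | yes refl rewrite remove-∷-≡ {x} (filterᵇ P xs) | ≡ᵇ-refl x = remove-filterᵇ a P xs
...   | no x≢a   rewrite remove-∷-≢ (filterᵇ P xs) x≢a | dec-false (x ≟ a) x≢a =
  cong (x ∷_) (remove-filterᵇ a P xs)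

any-remove : ∀ (P : ℕ → Bool) {x} xs → P x ≡ false → any P (remove x xs) ≡ any P xs
any-remove P     []       Px≡false = refl
any-remove P {x} (y ∷ xs) Px≡false with y ≟ x
... | yes refl rewrite remove-∷-≡ {y} xs | Px≡false = any-remove P xs Px≡false
... | no  y≢x  rewrite remove-∷-≢ xs y≢x = cong (P y ∨_) (any-remove P xs Px≡false)

count-positive : ∀ (P : ℕ → Bool) xs → 0 < count P xs → ∃ λ x → x ∈ xs × P x ≡ true
count-positive P (x ∷ xs) 0<count with P x in Px
... | true  = x , here refl , Px
... | false with y , y∈xs , Py ← count-positive P xs 0<count = y , there y∈xs , Py

segment : ℕ → ℕ → List ℕ
segment a zero    = []
segment a (suc L) = a ∷ segment (suc a) L

interval≡segment : ∀ a b → interval a b ≡ segment a (suc b ∸ a)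
interval≡segment a b = trans (map-applyUpTo id (a +_) (suc b ∸ a)) (applyUpTo-+ a (suc b ∸ a))
  where
  applyUpTo-+ : ∀ a L → applyUpTo (a +_) L ≡ segment a L
  applyUpTo-+ a zero    = refl
  applyUpTo-+ a (suc L) =
    cong₂ _∷_ (+-identityʳ a) (trans (applyUpTo-cong L (+-suc a)) (applyUpTo-+ (suc a) L))
    where
    applyUpTo-cong : ∀ {f g : ℕ → ℕ} L → (∀ i → f i ≡ g i) → applyUpTo f L ≡ applyUpTo g L
    applyUpTo-cong zero    f≗g = refl
    applyUpTo-cong (suc L) f≗g = cong₂ _∷_ (f≗g 0) (applyUpTo-cong L (f≗g ∘ suc))

length-segment : ∀ a L → length (segment a L) ≡ L
length-segment a zero    = refl
length-segment a (suc L) = cong suc (length-segment (suc a) L)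

segment-lower : ∀ a L → All (a ≤_) (segment a L)
segment-lower a zero    = []
segment-lower a (suc L) = ≤-refl ∷ All.map (≤-trans (n≤1+n a)) (segment-lower (suc a) L)

segment-upper : ∀ a L → All (_< a + L) (segment a L)
segment-upper a zero    = []
segment-upper a (suc L) rewrite +-suc a L = s≤s (m≤m+n a L) ∷ segment-upper (suc a) L

segment-increasing : ∀ a L → Increasing (segment a L)
segment-increasing a zero    = []
segment-increasing a (suc L) = segment-lower (suc a) L ∷ segment-increasing (suc a) L

∈-segment : ∀ {a L v} → a ≤ v → v < a + L → v ∈ segment a L
∈-segment {a} {zero}  a≤v v<a+0 = ⊥-elim (<⇒≱ v<a+0 (≤-trans (≤-reflexive (+-identityʳ a)) a≤v))
∈-segment {a} {suc L} {v} a≤v v<a+L with a ≟ v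
... | yes refl = here refl
... | no  a≢v  = there (∈-segment (≤∧≢⇒< a≤v a≢v) (subst (v <_) (+-suc a L) v<a+L))

segment-++ : ∀ a L₁ L₂ → segment a (L₁ + L₂) ≡ segment a L₁ ++ segment (a + L₁) L₂
segment-++ a zero     L₂ = cong (λ b → segment b L₂) (sym (+-identityʳ a))
segment-++ a (suc L₁) L₂ =
  cong (a ∷_) (trans (segment-++ (suc a) L₁ L₂) (cong (λ b → segment (suc a) L₁ ++ segment b L₂) (sym (+-suc a L₁))))

-- Arrangements, and permutations as words covering [1, n]

∑Arr : ℕ → List ℕ → (List ℕ → ℕ) → ℕ
∑Arr zero    R f = f []
∑Arr (suc k) R f = ∑[ a ∈ R ] ∑Arr k (remove a R) (λ w → f (a ∷ w))

Arrangement : ℕ → List ℕ → List ℕ → Set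
Arrangement zero    R w       = w ≡ []
Arrangement (suc k) R []      = ⊥
Arrangement (suc k) R (a ∷ w) = a ∈ R × Arrangement k (remove a R) w

∑Arr-cong : ∀ k R {f g : List ℕ → ℕ} → (∀ w → Arrangement k R w → f w ≡ g w) → ∑Arr k R f ≡ ∑Arr k R g
∑Arr-cong zero    R f≗g = f≗g [] refl
∑Arr-cong (suc k) R f≗g = ∑-cong R λ {a} a∈R → ∑Arr-cong k (remove a R) λ w w∈ → f≗g (a ∷ w) (a∈R , w∈)

∑Arr-*ˡ : ∀ k R c (f : List ℕ → ℕ) → ∑Arr k R (λ w → c * f w) ≡ c * ∑Arr k R f
∑Arr-*ˡ zero    R c f = refl
∑Arr-*ˡ (suc k) R c f = trans (∑-cong R λ {a} _ → ∑Arr-*ˡ k (remove a R) c (λ w → f (a ∷ w))) (∑-*ˡ c _ R)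

∑Arr-zero : ∀ k R → ∑Arr k R (λ _ → 0) ≡ 0
∑Arr-zero zero    R = refl
∑Arr-zero (suc k) R = ∑-vanishes R λ {a} _ → ∑Arr-zero k (remove a R)

∑-arrangement : ∀ (f : ℕ → ℕ) k {R w} → Increasing R → length R ≡ k → Arrangement k R w → ∑ f w ≡ ∑ f R
∑-arrangement f zero    {[]}     _  _      refl           = refl
∑-arrangement f (suc k) {R} {a ∷ w} R↑ |R|≡1+k (a∈R , w∈) =
  trans (cong (f a +_) (∑-arrangement f k (Increasing-remove R↑) (length-remove-∈ R↑ a∈R |R|≡1+k) w∈))
        (sym (∑-remove f R↑ a∈R))

covers-too-short : ∀ w {B} → Increasing B → length w < length B → all (_∈ᵇ w) B ≡ false
covers-too-short []      {b ∷ B} _  _        = refl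
covers-too-short (x ∷ w) {B}     B↑ |w|<|B| =
  trans (all-remove x (_∈ᵇ w) B)
        (covers-too-short w (Increasing-remove B↑) (≤-pred (≤-trans |w|<|B| (length-remove-≤ x B↑))))

∑Covering : ℕ → List ℕ → List ℕ → (List ℕ → ℕ) → ℕ
∑Covering k A B f = ∑[ w ∈ words k A ] (if all (_∈ᵇ w) B then f w else 0)

∑Covering-suc : ∀ k A B f → ∑Covering (suc k) A B f ≡ ∑[ a ∈ A ] ∑Covering k A (remove a B) (λ w → f (a ∷ w))
∑Covering-suc k A B f =
  trans (∑-concatMap _ (λ a → map (a ∷_) (words k A)) A)
        (∑-cong A λ {a} _ → trans (∑-map _ (a ∷_) (words k A))
          (∑-cong (words k A) λ {w} _ → cong (λ c → if c then f (a ∷ w) else 0) (all-remove a (_∈ᵇ w) B)))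

∑Covering-too-many : ∀ k A {B} f → Increasing B → k < length B → ∑Covering k A B f ≡ 0
∑Covering-too-many zero    A {b ∷ B} f _  _      = refl
∑Covering-too-many (suc k) A {B}     f B↑ k<|B| =
  trans (∑Covering-suc k A B f) (∑-vanishes A λ {a} _ →
    ∑Covering-too-many k A (λ w → f (a ∷ w)) (Increasing-remove B↑) (≤-pred (≤-trans k<|B| (length-remove-≤ a B↑))))

-- Stated for the sublists filterᵇ P A of A, which is what the induction on k needs.
∑Covering-filter : ∀ k (P : ℕ → Bool) f {A} → Increasing A → length (filterᵇ P A) ≡ k →
                   ∑Covering k A (filterᵇ P A) f ≡ ∑Arr k (filterᵇ P A) f
∑Covering-filter zero    P f {A} A↑ |Aᴾ|≡0 with filterᵇ P A
... | [] = +-identityʳ (f [])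
∑Covering-filter (suc k) P f {A} A↑ |Aᴾ|≡1+k =
  trans (∑Covering-suc k A Aᴾ f) (trans (∑-cong A first-letter) (sym (∑-filterᵇ P _ A)))
  where
  Aᴾ : List ℕ
  Aᴾ = filterᵇ P A
  first-letter : ∀ {a} → a ∈ A → ∑Covering k A (remove a Aᴾ) (λ w → f (a ∷ w))
                               ≡ (if P a then ∑Arr k (remove a Aᴾ) (λ w → f (a ∷ w)) else 0)
  first-letter {a} a∈A with P a in Pa
  ... | true rewrite remove-filterᵇ a P A =
    ∑Covering-filter k _ (λ w → f (a ∷ w)) A↑
      (subst (λ X → length X ≡ k) (remove-filterᵇ a P A)
             (length-remove-∈ (Increasing-filterᵇ P A↑) (∈-filterᵇ P a∈A Pa) |Aᴾ|≡1+k))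
  ... | false rewrite remove-∉ {a} {Aᴾ} (∉-filterᵇ P {xs = A} Pa) =
    ∑Covering-too-many k A (λ w → f (a ∷ w)) (Increasing-filterᵇ P A↑) (≤-reflexive (sym |Aᴾ|≡1+k))

∑-perms : ∀ n (g : List ℕ → ℕ) → ∑ g (perms n) ≡ ∑Arr n (segment 1 n) g
∑-perms n g = begin
  ∑ g (perms n)                                        ≡⟨ ∑-filterᵇ (isPermᵇ n) g (words n (interval 1 n)) ⟩
  ∑Covering n (interval 1 n) (interval 1 n) g          ≡⟨ cong (λ A → ∑Covering n A A g) (interval≡segment 1 n) ⟩
  ∑Covering n [1⋯n] [1⋯n] g                            ≡⟨ cong (λ B → ∑Covering n [1⋯n] B g) (sym filterᵇ-true) ⟩
  ∑Covering n [1⋯n] (filterᵇ (λ _ → true) [1⋯n]) g     ≡⟨ ∑Covering-filter n _ g (segment-increasing 1 n) |[1⋯n]| ⟩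
  ∑Arr n (filterᵇ (λ _ → true) [1⋯n]) g                ≡⟨ cong (λ R → ∑Arr n R g) filterᵇ-true ⟩
  ∑Arr n [1⋯n] g                                       ∎
  where
  open ≡-Reasoning
  [1⋯n] : List ℕ
  [1⋯n] = segment 1 n
  filterᵇ-true : filterᵇ (λ _ → true) [1⋯n] ≡ [1⋯n]
  filterᵇ-true = filter-all (T? ∘ λ _ → true) (All.tabulate (λ _ → tt))
  |[1⋯n]| : length (filterᵇ (λ _ → true) [1⋯n]) ≡ n
  |[1⋯n]| = trans (cong length filterᵇ-true) (length-segment 1 n)

-- Descent sets

_⇔ᵇ_ : Bool → Bool → Bool
b ⇔ᵇ true  = b
b ⇔ᵇ false = not b

⇔ᵇ-trueˡ : ∀ b → true ⇔ᵇ b ≡ b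
⇔ᵇ-trueˡ true  = refl
⇔ᵇ-trueˡ false = refl

⇔ᵇ-falseˡ : ∀ b → false ⇔ᵇ b ≡ not b
⇔ᵇ-falseˡ true  = refl
⇔ᵇ-falseˡ false = refl

_≈ᵇ_ : List ℕ → List ℕ → Bool
D ≈ᵇ S = all (_∈ᵇ S) D ∧ all (_∈ᵇ D) S

-- p ∷ w with p at position i: each position i′ ≥ i is a descent iff i′ ∈ S, and every element of
-- S lies before the position of the last letter.
hasDescents : List ℕ → ℕ → ℕ → List ℕ → Bool
hasDescents S i p []       = all (_<ᵇ i) S
hasDescents S i p (x ∷ xs) = ((i ∈ᵇ S) ⇔ᵇ (x <ᵇ p)) ∧ hasDescents S (suc i) x xs

desFrom-lower : ∀ i w → All (i ≤_) (desFrom i w)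
desFrom-lower i []           = []
desFrom-lower i (x ∷ [])     = []
desFrom-lower i (x ∷ y ∷ ys) with ih ← All.map (≤-trans (n≤1+n i)) (desFrom-lower (suc i) (y ∷ ys)) | y <ᵇ x
... | true  = ≤-refl ∷ ih
... | false = ih

module _ {i : ℕ} {D : List ℕ} (i∉D : i ∉ D) where

  private
    all-∈ᵇ-remove : ∀ S → all (_∈ᵇ S) D ≡ all (_∈ᵇ remove i S) D
    all-∈ᵇ-remove S = all-cong D λ {v} v∈D → sym (begin
      (v ∈ᵇ remove i S)          ≡⟨ ∈ᵇ-remove v i S ⟩
      (v ∈ᵇ S) ∧ not (v ≡ᵇ i)    ≡⟨ cong (λ b → (v ∈ᵇ S) ∧ not b) (dec-false (v ≟ i) λ { refl → i∉D v∈D }) ⟩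
      (v ∈ᵇ S) ∧ true            ≡⟨ ∧-identityʳ _ ⟩
      (v ∈ᵇ S)                   ∎)
      where open ≡-Reasoning

  ≈ᵇ-if : ∀ b S → ((if b then i ∷ D else D) ≈ᵇ S) ≡ ((i ∈ᵇ S) ⇔ᵇ b) ∧ (D ≈ᵇ remove i S)
  ≈ᵇ-if true  S rewrite all-∈ᵇ-remove S | all-remove i (_∈ᵇ D) S = ∧-assoc (i ∈ᵇ S) _ _
  ≈ᵇ-if false S
    rewrite all-∈ᵇ-remove S | all-split i (_∈ᵇ D) S | dec-false (i ∈ᵇ? D) i∉D | ∨-identityʳ (not (i ∈ᵇ S)) =
    ∧.x∙yz≈y∙xz (all (_∈ᵇ remove i S) D) (not (i ∈ᵇ S)) (all (_∈ᵇ D) (remove i S))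

hasDescents-remove : ∀ S {j i} p xs → j < i → hasDescents S i p xs ≡ hasDescents (remove j S) i p xs
hasDescents-remove S {j} {i} p [] j<i
  rewrite all-split j (_<ᵇ i) S | dec-true (j <? i) j<i | ∨-zeroʳ (not (j ∈ᵇ S)) = refl
hasDescents-remove S {j} {i} p (x ∷ xs) j<i
  rewrite ∈ᵇ-remove i j S | dec-false (i ≟ j) (>⇒≢ j<i) | ∧-identityʳ (i ∈ᵇ S) =
  cong (((i ∈ᵇ S) ⇔ᵇ (x <ᵇ p)) ∧_) (hasDescents-remove S x xs (≤-trans j<i (n≤1+n i)))

desFrom≈ᵇ : ∀ S i p xs → All (i ≤_) S → (desFrom i (p ∷ xs) ≈ᵇ S) ≡ hasDescents S i p xs
desFrom≈ᵇ S i p []       i≤S = all-cong S λ s∈S → sym (dec-false (_ <? i) (≤⇒≯ (All.lookup i≤S s∈S)))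
desFrom≈ᵇ S i p (x ∷ xs) i≤S =
  trans (≈ᵇ-if i∉D (x <ᵇ p) S)
        (cong (((i ∈ᵇ S) ⇔ᵇ (x <ᵇ p)) ∧_)
              (trans (desFrom≈ᵇ (remove i S) (suc i) x xs i<S∖i) (sym (hasDescents-remove S x xs ≤-refl))))
  where
  i∉D : i ∉ desFrom (suc i) (x ∷ xs)
  i∉D i∈D = n≮n i (All.lookup (desFrom-lower (suc i) (x ∷ xs)) i∈D)
  i<S∖i : All (suc i ≤_) (remove i S)
  i<S∖i = All.tabulate λ v∈S∖i → let v∈S , v≢i = ∈-remove⁻ S v∈S∖i in
                                 ≤∧≢⇒< (All.lookup i≤S v∈S) (v≢i ∘ sym)

DesEqᵇ≡hasDescents : ∀ S → All (1 ≤_) S → ∀ w → DesEqᵇ w S ≡ hasDescents S 0 0 w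
DesEqᵇ≡hasDescents S 1≤S []       = refl
DesEqᵇ≡hasDescents S 1≤S (x ∷ xs)
  rewrite desFrom≈ᵇ S 1 x xs 1≤S | dec-false (0 ∈ᵇ? S) (λ 0∈S → n≮n 0 (All.lookup 1≤S 0∈S)) = refl

-- q-binomial coefficients

module QBinomial (q : ℕ) where

  qint-+ : ∀ a b → qint q (a + b) ≡ qint q a + q ^ a * qint q b
  qint-+ a b = begin
    qint q (a + b)                              ≡⟨ ∑-upTo (a + b) (q ^_) ⟩
    ∑< (a + b) (q ^_)                           ≡⟨ ∑<-+ a b (q ^_) ⟩
    ∑< a (q ^_) + (∑[ j < b ] q ^ (a + j))       ≡⟨ cong₂ _+_ (sym (∑-upTo a (q ^_))) (∑<-cong b (^-distribˡ-+-* q a)) ⟩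
    qint q a + (∑[ j < b ] q ^ a * q ^ j)        ≡⟨ cong (qint q a +_) (∑<-*ˡ b (q ^ a) (q ^_)) ⟩
    qint q a + q ^ a * ∑< b (q ^_)              ≡⟨ cong (λ s → qint q a + q ^ a * s) (sym (∑-upTo b (q ^_))) ⟩
    qint q a + q ^ a * qint q b                 ∎
    where open ≡-Reasoning

  qChoose : ℕ → ℕ → ℕ
  qChoose zero    zero    = 1
  qChoose zero    (suc j) = 0
  qChoose (suc u) zero    = 1
  qChoose (suc u) (suc j) = qChoose u (suc j) + q ^ (u ∸ j) * qChoose u j

  qChoose-0 : ∀ u → qChoose u 0 ≡ 1
  qChoose-0 zero    = refl
  qChoose-0 (suc u) = refl

  qChoose-vanishes : ∀ {u j} → u < j → qChoose u j ≡ 0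
  qChoose-vanishes {zero}  {suc j} _ = refl
  qChoose-vanishes {suc u} {suc j} (s≤s u<j)
    rewrite qChoose-vanishes (m<n⇒m<1+n u<j) | qChoose-vanishes u<j = *-zeroʳ (q ^ (u ∸ j))

  qChoose-*-qfact : ∀ {u j} → j ≤ u → qChoose u j * (qfact q (u ∸ j) * qfact q j) ≡ qfact q u
  qChoose-*-qfact {zero}  {zero} _ = refl
  qChoose-*-qfact {suc u} {zero} _ = trans (*-identityˡ _) (*-identityʳ (qfact q (suc u)))
  qChoose-*-qfact {suc u} {suc j} (s≤s j≤u) = begin
    (qChoose u (suc j) + q ^ (u ∸ j) * qChoose u j) * (F (u ∸ j) * (I (suc j) * F j))
      ≡⟨ expand (qChoose u (suc j)) (q ^ (u ∸ j)) (qChoose u j) (F (u ∸ j)) (I (suc j)) (F j) ⟩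
    qChoose u (suc j) * (F (u ∸ j) * F (suc j)) + q ^ (u ∸ j) * I (suc j) * (qChoose u j * (F (u ∸ j) * F j))
      ≡⟨ cong₂ _+_ (qChoose-suc-*-qfact j≤u) (cong (q ^ (u ∸ j) * I (suc j) *_) (qChoose-*-qfact j≤u)) ⟩
    F u * I (u ∸ j) + q ^ (u ∸ j) * I (suc j) * F u
      ≡⟨ collect (F u) (I (u ∸ j)) (q ^ (u ∸ j) * I (suc j)) ⟩
    (I (u ∸ j) + q ^ (u ∸ j) * I (suc j)) * F u
      ≡⟨ cong (_* F u) (sym (qint-+ (u ∸ j) (suc j))) ⟩
    I (u ∸ j + suc j) * F u
      ≡⟨ cong (λ n → I n * F u) (trans (+-suc (u ∸ j) j) (cong suc (m∸n+n≡m j≤u))) ⟩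
    I (suc u) * F u ∎
    where
    open ≡-Reasoning
    I F : ℕ → ℕ
    I = qint q
    F = qfact q
    expand : ∀ A B C D E G → (A + B * C) * (D * (E * G)) ≡ A * (D * (E * G)) + B * E * (C * (D * G))
    expand = solve-∀
    collect : ∀ A B C → A * B + C * A ≡ (B + C) * A
    collect = solve-∀
    qChoose-suc-*-qfact : ∀ {u j} → j ≤ u → qChoose u (suc j) * (F (u ∸ j) * F (suc j)) ≡ F u * I (u ∸ j)
    qChoose-suc-*-qfact {u} {j} j≤u with m≤n⇒m<n∨m≡n j≤u
    ... | inj₂ refl rewrite qChoose-vanishes (n<1+n j) | n∸n≡0 j = sym (*-zeroʳ (F j))
    ... | inj₁ j<u rewrite +-∸-assoc 1 j<u =
      trans (shuffle (qChoose u (suc j)) (I (suc (u ∸ suc j))) (F (u ∸ suc j)) (F (suc j)))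
            (cong (_* I (suc (u ∸ suc j))) (qChoose-*-qfact j<u))
      where
      shuffle : ∀ A B C D → A * (B * C * D) ≡ A * (C * D) * B
      shuffle = solve-∀

  qChoose≡qbinom : ∀ u j → qChoose u j ≡ qbinom q u j
  qChoose≡qbinom u j with j ≤ᵇ u in j≤ᵇu
  ... | false = qChoose-vanishes {u} {j} (≰⇒> λ j≤u → subst T j≤ᵇu (≤⇒≤ᵇ j≤u))
  ... | true  = sym (begin
    (qfact q u / d) {{_}}
      ≡⟨ cong (λ n → (n / d) {{d≢0}}) (sym (qChoose-*-qfact (≤ᵇ⇒≤ j u (subst T (sym j≤ᵇu) _)))) ⟩
    (qChoose u j * d / d) {{_}}
      ≡⟨ m*n/n≡m (qChoose u j) d {{d≢0}} ⟩
    qChoose u j ∎)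
    where
    open ≡-Reasoning
    d : ℕ
    d = qfact q (u ∸ j) * qfact q j
    d≢0 : NonZero d
    d≢0 = m*n≢0 (qfact q (u ∸ j)) (qfact q j) {{qfact-nonZero q (u ∸ j)}} {{qfact-nonZero q j}}

  coeff : ℕ → ℕ → ℕ → ℕ
  coeff zero    k zero    = 1
  coeff zero    k (suc j) = 0
  coeff (suc u) k zero    = q ^ k * coeff u k zero
  coeff (suc u) k (suc j) = q ^ k * coeff u k (suc j) + coeff u (suc k) j

  coeff-closed : ∀ u k j → coeff u k j ≡ q ^ (k * (u ∸ j)) * qChoose u j
  coeff-closed zero    k zero    rewrite *-zeroʳ k = refl
  coeff-closed zero    k (suc j) = sym (*-zeroʳ (q ^ (k * 0)))
  coeff-closed (suc u) k zero    rewrite coeff-closed u k zero | qChoose-0 u | *-suc k u | ^-distribˡ-+-* q k (k * u) =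
    sym (*-assoc (q ^ k) (q ^ (k * u)) 1)
  coeff-closed (suc u) k (suc j) rewrite coeff-closed u k (suc j) | coeff-closed u (suc k) j with j <? u
  ... | yes j<u rewrite +-∸-assoc 1 j<u = shifted (u ∸ suc j) (qChoose u (suc j)) (qChoose u j)
    where
    shifted : ∀ d B C → q ^ k * (q ^ (k * d) * B) + q ^ (suc k * suc d) * C ≡ q ^ (k * suc d) * (B + q ^ suc d * C)
    shifted d B C rewrite *-suc k d | ^-distribˡ-+-* q (suc d) (k + k * d) | ^-distribˡ-+-* q k (k * d) =
      ring (q ^ k) (q ^ (k * d)) B (q ^ suc d) C
      where
      ring : ∀ K A B E C → K * (A * B) + E * (K * A) * C ≡ K * A * (B + E * C)
      ring = solve-∀
  ... | no  j≮u rewrite qChoose-vanishes (s≤s (≮⇒≥ j≮u)) | ^-distribˡ-+-* q (u ∸ j) (k * (u ∸ j)) =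
    ring (q ^ k) (q ^ (k * (u ∸ suc j))) (q ^ (u ∸ j)) (q ^ (k * (u ∸ j))) (qChoose u j)
    where
    ring : ∀ K A E B C → K * (A * 0) + E * B * C ≡ B * (0 + E * C)
    ring = solve-∀

  module PascalExpansion (G : ℕ → ℕ → ℕ) (G-pascal : ∀ u k → G (suc u) k ≡ q ^ k * G u k + G u (suc k)) where

    expansion : ∀ u k L → u < L → G u k ≡ ∑[ j < L ] G 0 (k + j) * coeff u k j
    expansion zero    k (suc L) _ = sym (begin
      G 0 (k + 0) * 1 + (∑[ j < L ] G 0 (k + suc j) * 0)
        ≡⟨ cong₂ _+_ (*-identityʳ _) (∑<-vanishes L λ j → *-zeroʳ (G 0 (k + suc j))) ⟩
      G 0 (k + 0) + 0
        ≡⟨ trans (+-identityʳ _) (cong (G 0) (+-identityʳ k)) ⟩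
      G 0 k ∎)
      where open ≡-Reasoning
    expansion (suc u) k (suc L) (s≤s u<L) = begin
      G (suc u) k
        ≡⟨ G-pascal u k ⟩
      q ^ k * G u k + G u (suc k)
        ≡⟨ cong₂ (λ a b → q ^ k * a + b) (expansion u k (suc L) (m<n⇒m<1+n u<L)) (expansion u (suc k) L u<L) ⟩
      q ^ k * (G 0 (k + 0) * coeff u k 0 + X) + Y
        ≡⟨ ring (q ^ k) (G 0 (k + 0)) (coeff u k 0) X Y ⟩
      G 0 (k + 0) * (q ^ k * coeff u k 0) + (q ^ k * X + Y)
        ≡⟨ cong (λ s → G 0 (k + 0) * (q ^ k * coeff u k 0) + (s + Y)) (sym (∑<-*ˡ L (q ^ k) _)) ⟩
      G 0 (k + 0) * (q ^ k * coeff u k 0) + ((∑[ j < L ] q ^ k * (G 0 (k + suc j) * coeff u k (suc j))) + Y)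
        ≡⟨ cong (G 0 (k + 0) * (q ^ k * coeff u k 0) +_) (sym (∑<-distrib-+ L _ _)) ⟩
      G 0 (k + 0) * (q ^ k * coeff u k 0)
        + (∑[ j < L ] q ^ k * (G 0 (k + suc j) * coeff u k (suc j)) + G 0 (suc k + j) * coeff u (suc k) j)
        ≡⟨ cong (G 0 (k + 0) * (q ^ k * coeff u k 0) +_) (∑<-cong L collect) ⟩
      ∑[ j < suc L ] G 0 (k + j) * coeff (suc u) k j ∎
      where
      open ≡-Reasoning
      X Y : ℕ
      X = ∑[ j < L ] G 0 (k + suc j) * coeff u k (suc j)
      Y = ∑[ j < L ] G 0 (suc k + j) * coeff u (suc k) j
      ring : ∀ K A B X Y → K * (A * B + X) + Y ≡ A * (K * B) + (K * X + Y)
      ring = solve-∀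
      collect : ∀ j → q ^ k * (G 0 (k + suc j) * coeff u k (suc j)) + G 0 (suc k + j) * coeff u (suc k) j
                      ≡ G 0 (k + suc j) * coeff (suc u) k (suc j)
      collect j rewrite +-suc k j = ring′ (q ^ k) (G 0 (suc (k + j))) (coeff u k (suc j)) (coeff u (suc k) j)
        where
        ring′ : ∀ K A B D → K * (A * B) + A * D ≡ A * (K * B + D)
        ring′ = solve-∀

    expansion-qChoose : ∀ u L → u < L → G u 0 ≡ ∑[ j < L ] G 0 j * qChoose u j
    expansion-qChoose u L u<L =
      trans (expansion u 0 L u<L) (∑<-cong L λ j → cong (G 0 j *_) (trans (coeff-closed u 0 j) (+-identityʳ _)))

-- Order-preserving relabelling

module StrictlyMonotone (φ : ℕ → ℕ) (φ-mono : ∀ {x y} → x < y → φ x < φ y) where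

  φ-reflects-< : ∀ {x y} → φ x < φ y → x < y
  φ-reflects-< {x} {y} φx<φy with <-cmp x y
  ... | tri< x<y _ _ = x<y
  ... | tri≈ _ refl _ = ⊥-elim (<-irrefl refl φx<φy)
  ... | tri> _ _ y<x = ⊥-elim (<-asym φx<φy (φ-mono y<x))

  φ-injective : ∀ {x y} → φ x ≡ φ y → x ≡ y
  φ-injective {x} {y} φx≡φy with <-cmp x y
  ... | tri< x<y _ _ = ⊥-elim (<-irrefl φx≡φy (φ-mono x<y))
  ... | tri≈ _ x≡y _ = x≡y
  ... | tri> _ _ y<x = ⊥-elim (<-irrefl (sym φx≡φy) (φ-mono y<x))

  φ-<ᵇ : ∀ x y → (φ x <ᵇ φ y) ≡ (x <ᵇ y)
  φ-<ᵇ x y = does-≡ (φ x <? φ y) (map′ φ-mono φ-reflects-< (x <? y))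

  ∈ᵇ-map : ∀ v R → (φ v ∈ᵇ map φ R) ≡ (v ∈ᵇ R)
  ∈ᵇ-map v R = does-≡ (φ v ∈ᵇ? map φ R) (map′ (∈-map⁺ φ) from-map (v ∈ᵇ? R))
    where
    from-map : φ v ∈ map φ R → v ∈ R
    from-map φv∈ with u , u∈R , φv≡φu ← ∈-map⁻ φ φv∈ = subst (_∈ R) (sym (φ-injective φv≡φu)) u∈R

  remove-map : ∀ a R → remove (φ a) (map φ R) ≡ map φ (remove a R)
  remove-map a []      = refl
  remove-map a (x ∷ R) with x ≟ a
  ... | yes refl rewrite remove-∷-≡ {φ x} (map φ R) | remove-∷-≡ {x} R = remove-map x R
  ... | no  x≢a  rewrite remove-∷-≢ (map φ R) (x≢a ∘ φ-injective) | remove-∷-≢ R x≢a = cong (φ x ∷_) (remove-map a R)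

skip : ℕ → ℕ → ℕ
skip L y = if L <ᵇ y then suc y else y

skip-mono : ∀ L {x y} → x < y → skip L x < skip L y
skip-mono L {x} {y} x<y with L <ᵇ x | <ᵇ-reflects-< L x | L <ᵇ y | <ᵇ-reflects-< L y
... | true  | _        | true  | _        = s≤s x<y
... | true  | ofʸ L<x  | false | ofⁿ L≮y = ⊥-elim (L≮y (<-trans L<x x<y))
... | false | _        | true  | _        = m<n⇒m<1+n x<y
... | false | _        | false | _        = x<y

map-segment : ∀ (f : ℕ → ℕ) d a k → (∀ {y} → y ∈ segment a k → f y ≡ d + y) → map f (segment a k) ≡ segment (d + a) k
map-segment f d a zero    f≗d+ = refl
map-segment f d a (suc k) f≗d+ =
  cong₂ _∷_ (f≗d+ (here refl)) (trans (map-segment f d (suc a) k (f≗d+ ∘ there)) (cong (λ b → segment b k) (+-suc d a)))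

module _ (L k : ℕ) where

  private
    low<x : All (_< suc L) (segment 1 L)
    low<x = segment-upper 1 L
    x<high : All (suc L <_) (segment (2 + L) k)
    x<high = segment-lower (2 + L) k
    segment-middle : segment 1 (L + suc k) ≡ segment 1 L ++ suc L ∷ segment (2 + L) k
    segment-middle = segment-++ 1 L (suc k)

  middle-∈ : suc L ∈ segment 1 (L + suc k)
  middle-∈ = subst (suc L ∈_) (sym segment-middle) (∈-++⁺ʳ (segment 1 L) (here refl))

  middle-∉-high : suc L ∉ segment (2 + L) k
  middle-∉-high x∈high = n≮n (suc L) (All.lookup x<high x∈high)

  above-middle-∈ : ∀ {y} → y ∈ segment 1 (L + suc k) → suc L < y → y ∈ segment (2 + L) k
  above-middle-∈ {y} y∈R x<y =
    ∈-segment x<y (subst (y <_) (cong suc (+-suc L k)) (All.lookup (segment-upper 1 (L + suc k)) y∈R))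

  count-below-middle : count (_<ᵇ suc L) (segment 1 (L + suc k)) ≡ L
  count-below-middle
    rewrite segment-middle | ∑-++ (λ y → 𝟙 (y <ᵇ suc L)) (segment 1 L) (suc L ∷ segment (2 + L) k) | <ᵇ-irrefl (suc L)
          | count-all (_<ᵇ suc L) (segment 1 L) (λ y∈ → dec-true (_ <? suc L) (All.lookup low<x y∈))
          | count-none (_<ᵇ suc L) (segment (2 + L) k) (λ y∈ → dec-false (_ <? suc L) (<⇒≯ (All.lookup x<high y∈)))
          | length-segment 1 L = +-identityʳ L

  count-above-middle : count (suc L <ᵇ_) (segment 1 (L + suc k)) ≡ k
  count-above-middle
    rewrite segment-middle | ∑-++ (λ y → 𝟙 (suc L <ᵇ y)) (segment 1 L) (suc L ∷ segment (2 + L) k) | <ᵇ-irrefl (suc L)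
          | count-none (suc L <ᵇ_) (segment 1 L) (λ y∈ → dec-false (suc L <? _) (<⇒≯ (All.lookup low<x y∈)))
          | count-all (suc L <ᵇ_) (segment (2 + L) k) (λ y∈ → dec-true (suc L <? _) (All.lookup x<high y∈))
    = length-segment (2 + L) k

  map-skip-high : map (skip L) (segment (suc L) k) ≡ segment (2 + L) k
  map-skip-high = map-segment (skip L) 1 (suc L) k skip-high
    where
    skip-high : ∀ {y} → y ∈ segment (suc L) k → skip L y ≡ 1 + y
    skip-high y∈ rewrite dec-true (L <? _) (All.lookup (segment-lower (suc L) k) y∈) = refl

  remove-middle : remove (suc L) (segment 1 (L + suc k)) ≡ map (skip L) (segment 1 (L + k))
  remove-middle = begin
    remove (suc L) (segment 1 (L + suc k))
      ≡⟨ cong (remove (suc L)) segment-middle ⟩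
    remove (suc L) (segment 1 L ++ suc L ∷ segment (2 + L) k)
      ≡⟨ filter-++ _ (segment 1 L) (suc L ∷ segment (2 + L) k) ⟩
    remove (suc L) (segment 1 L) ++ remove (suc L) (suc L ∷ segment (2 + L) k)
      ≡⟨ cong₂ _++_ (remove-∉ (λ x∈low → n≮n (suc L) (All.lookup low<x x∈low))) (remove-head x<high) ⟩
    segment 1 L ++ segment (2 + L) k
      ≡⟨ cong₂ _++_ (sym (map-segment (skip L) 0 1 L skip-low)) (sym map-skip-high) ⟩
    map (skip L) (segment 1 L) ++ map (skip L) (segment (suc L) k)
      ≡⟨ sym (trans (cong (map (skip L)) (segment-++ 1 L k)) (map-++ (skip L) (segment 1 L) (segment (suc L) k))) ⟩
    map (skip L) (segment 1 (L + k)) ∎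
    where
    open ≡-Reasoning
    skip-low : ∀ {y} → y ∈ segment 1 L → skip L y ≡ 0 + y
    skip-low y∈ rewrite dec-false (L <? _) (≤⇒≯ (≤-pred (All.lookup low<x y∈))) = refl

-- Prefix sums

allAbove : ℕ → List ℕ → Bool
allAbove p R = all (λ y → not (y <ᵇ p)) R

module _ {x : ℕ} (p : ℕ) {R : List ℕ} (x<R : All (x <_) R) where

  private
    ≮-beyond : ¬ x < p → ∀ {y} → y ∈ R → (y <ᵇ p) ≡ false
    ≮-beyond x≮p y∈R = dec-false (_ <? p) λ y<p → x≮p (<-trans (All.lookup x<R y∈R) y<p)

  allAbove-∷ : not (x <ᵇ p) ≡ allAbove p (x ∷ R)
  allAbove-∷ with x <ᵇ p | <ᵇ-reflects-< x p
  ... | true  | _        = refl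
  ... | false | ofⁿ x≮p = sym (all-true R λ y∈R → cong not (≮-beyond x≮p y∈R))

  any-<ᵇ-∷ : (x <ᵇ p) ≡ any (_<ᵇ p) (x ∷ R)
  any-<ᵇ-∷ with x <ᵇ p | <ᵇ-reflects-< x p
  ... | true  | _        = refl
  ... | false | ofⁿ x≮p = sym (any-false R (≮-beyond x≮p))

module PrefixSums (S : List ℕ) (q : ℕ) where

  nextTerm : ℕ → ℕ → List ℕ → (ℕ → ℕ) → ℕ → ℕ
  nextTerm i p R F a = if (i ∈ᵇ S) ⇔ᵇ (a <ᵇ p) then q ^ count (_<ᵇ a) R * F a else 0

  ∑Next : ℕ → ℕ → List ℕ → (ℕ → ℕ) → ℕ
  ∑Next i p R F = ∑ (nextTerm i p R F) R

  nextTerm-cong : ∀ i p R (F G : ℕ → ℕ) {a} → F a ≡ G a → nextTerm i p R F a ≡ nextTerm i p R G a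
  nextTerm-cong i p R F G {a} = cong (λ n → if (i ∈ᵇ S) ⇔ᵇ (a <ᵇ p) then q ^ count (_<ᵇ a) R * n else 0)

  ∑Next-cong : ∀ i p R {F G : ℕ → ℕ} → (∀ {a} → a ∈ R → F a ≡ G a) → ∑Next i p R F ≡ ∑Next i p R G
  ∑Next-cong i p R {F} {G} F≗G = ∑-cong R λ a∈R → nextTerm-cong i p R F G (F≗G a∈R)

  nextTerm-vanishes : ∀ i p R F {a} → F a ≡ 0 → nextTerm i p R F a ≡ 0
  nextTerm-vanishes i p R F {a} Fa≡0 rewrite Fa≡0 = if-*-zero ((i ∈ᵇ S) ⇔ᵇ (a <ᵇ p)) (q ^ count (_<ᵇ a) R)

  ∑Desc : ℕ → ℕ → ℕ → List ℕ → (List ℕ → Bool) → ℕ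
  ∑Desc k i p R C = ∑Arr k R (λ w → if hasDescents S i p w ∧ C w then q ^ inv w else 0)

  ∑Desc-cong : ∀ k i p R {C C′ : List ℕ → Bool} → (∀ w → C w ≡ C′ w) → ∑Desc k i p R C ≡ ∑Desc k i p R C′
  ∑Desc-cong k i p R C≗C′ =
    ∑Arr-cong k R λ w _ → cong (λ c → if hasDescents S i p w ∧ c then q ^ inv w else 0) (C≗C′ w)

  ∑Desc-suc : ∀ k i p R C → Increasing R → length R ≡ suc k →
              ∑Desc (suc k) i p R C ≡ ∑Next i p R (λ a → ∑Desc k (suc i) a (remove a R) (C ∘ (a ∷_)))
  ∑Desc-suc k i p R C R↑ |R| = ∑-cong R first-letter
    where
    first-letter : ∀ {a} → a ∈ R →
      ∑Arr k (remove a R) (λ w → if hasDescents S i p (a ∷ w) ∧ C (a ∷ w) then q ^ inv (a ∷ w) else 0)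
      ≡ (if (i ∈ᵇ S) ⇔ᵇ (a <ᵇ p) then q ^ count (_<ᵇ a) R * ∑Desc k (suc i) a (remove a R) (C ∘ (a ∷_)) else 0)
    first-letter {a} a∈R with (i ∈ᵇ S) ⇔ᵇ (a <ᵇ p)
    ... | false = ∑Arr-zero k (remove a R)
    ... | true  = trans (∑Arr-cong k (remove a R) factor) (∑Arr-*ˡ k (remove a R) (q ^ count (_<ᵇ a) R) _)
      where
      factor : ∀ w → Arrangement k (remove a R) w →
               (if hasDescents S (suc i) a w ∧ C (a ∷ w) then q ^ inv (a ∷ w) else 0)
               ≡ q ^ count (_<ᵇ a) R * (if hasDescents S (suc i) a w ∧ C (a ∷ w) then q ^ inv w else 0)
      factor w w∈ rewrite ∑-arrangement (λ y → 𝟙 (y <ᵇ a)) k (Increasing-remove R↑) (length-remove-∈ R↑ a∈R |R|) w∈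
                        | count-<ᵇ-remove R↑ a∈R | ^-distribˡ-+-* q (count (_<ᵇ a) R) (inv w) =
        if-*ʳ _ (q ^ count (_<ᵇ a) R) (q ^ inv w)

  noneLeft : List ℕ → List ℕ → Bool
  noneLeft M R = all (λ v → not (v ∈ᵇ R)) M

  placedWithin : List ℕ → List ℕ → ℕ → List ℕ → Bool
  placedWithin M R t w = all (λ v → not (v ∈ᵇ R) ∨ (v ∈ᵇ take t w)) M

  -- With p at position i, choose t more letters from R; a chosen letter a makes an inversion
  -- with each smaller letter still in R. The unused letters of R then follow in increasing order:
  -- no inversions, a descent before them iff one is below the last chosen letter, and none of
  -- them may belong to M.
  ∑Prefix : ℕ → ℕ → ℕ → List ℕ → List ℕ → ℕ
  ∑Prefix zero    i p R M = 𝟙 (noneLeft M R ∧ any (_<ᵇ p) R)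
  ∑Prefix (suc t) i p R M = ∑Next i p R (λ a → ∑Prefix t (suc i) a (remove a R) M)

  ∑Next-minimum : ∀ i p {x R} → All (x <_) R →
    ∑Next i p (x ∷ R) (λ a → 𝟙 (allAbove a (remove a (x ∷ R)))) ≡ 𝟙 ((i ∈ᵇ S) ⇔ᵇ (x <ᵇ p))
  ∑Next-minimum i p {x} {R} x<R = trans (cong₂ _+_ minimum (∑-vanishes R others)) (+-identityʳ _)
    where
    F : ℕ → ℕ
    F a = 𝟙 (allAbove a (remove a (x ∷ R)))
    minimum : nextTerm i p (x ∷ R) F x ≡ 𝟙 ((i ∈ᵇ S) ⇔ᵇ (x <ᵇ p))
    minimum rewrite remove-head x<R | <ᵇ-irrefl x
                  | count-none (_<ᵇ x) R (λ y∈R → dec-false (_ <? x) (<⇒≯ (All.lookup x<R y∈R)))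
                  | all-true {P = λ y → not (y <ᵇ x)} R (λ y∈R → cong not (dec-false (_ <? x) (<⇒≯ (All.lookup x<R y∈R))))
      with (i ∈ᵇ S) ⇔ᵇ (x <ᵇ p)
    ... | true  = refl
    ... | false = refl
    others : ∀ {a} → a ∈ R → nextTerm i p (x ∷ R) F a ≡ 0
    others {a} a∈R = nextTerm-vanishes i p (x ∷ R) F F-vanishes
      where
      F-vanishes : F a ≡ 0
      F-vanishes rewrite remove-∷-≢ R (<⇒≢ (All.lookup x<R a∈R)) | dec-true (x <? a) (All.lookup x<R a∈R) = refl

  placedWithin-∷ : ∀ M R a t w → placedWithin M R (suc t) (a ∷ w) ≡ placedWithin M (remove a R) t w
  placedWithin-∷ M R a t w = all-cong M λ {v} _ → begin
    not (v ∈ᵇ R) ∨ ((a ≡ᵇ v) ∨ (v ∈ᵇ take t w))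
      ≡⟨ cong (λ b → not (v ∈ᵇ R) ∨ (b ∨ (v ∈ᵇ take t w))) (≡ᵇ-sym a v) ⟩
    not (v ∈ᵇ R) ∨ ((v ≡ᵇ a) ∨ (v ∈ᵇ take t w))
      ≡⟨ de-morgan (v ∈ᵇ R) (v ≡ᵇ a) (v ∈ᵇ take t w) ⟩
    not ((v ∈ᵇ R) ∧ not (v ≡ᵇ a)) ∨ (v ∈ᵇ take t w)
      ≡⟨ cong (λ b → not b ∨ (v ∈ᵇ take t w)) (sym (∈ᵇ-remove v a R)) ⟩
    not (v ∈ᵇ remove a R) ∨ (v ∈ᵇ take t w) ∎
    where
    open ≡-Reasoning
    de-morgan : ∀ b c x → not b ∨ (c ∨ x) ≡ not (b ∧ not c) ∨ x
    de-morgan true  true  x = refl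
    de-morgan true  false x = refl
    de-morgan false c     x = refl

  module _ {m} (m∈S : m ∈ S) (S≤m : All (_≤ m) S) where

    ∑Desc-ascending : ∀ k i p R → m < i → Increasing R → length R ≡ k →
                      ∑Desc k i p R (λ _ → true) ≡ 𝟙 (allAbove p R)
    ∑Desc-first-letter : ∀ k i p {x R} → m ≤ i → Increasing (x ∷ R) → length (x ∷ R) ≡ suc k →
                         ∑Desc (suc k) i p (x ∷ R) (λ _ → true) ≡ 𝟙 ((i ∈ᵇ S) ⇔ᵇ (x <ᵇ p))

    ∑Desc-ascending zero    i p [] m<i _ _
      rewrite all-true S (λ s∈S → dec-true (_ <? i) (≤-<-trans (All.lookup S≤m s∈S) m<i)) = refl
    ∑Desc-ascending (suc k) i p (x ∷ R) m<i R↑@(x<R ∷ _) |R| = begin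
      ∑Desc (suc k) i p (x ∷ R) (λ _ → true)  ≡⟨ ∑Desc-first-letter k i p (<⇒≤ m<i) R↑ |R| ⟩
      𝟙 ((i ∈ᵇ S) ⇔ᵇ (x <ᵇ p))                 ≡⟨ cong (λ b → 𝟙 (b ⇔ᵇ (x <ᵇ p))) i∉S ⟩
      𝟙 (false ⇔ᵇ (x <ᵇ p))                    ≡⟨ cong 𝟙 (⇔ᵇ-falseˡ (x <ᵇ p)) ⟩
      𝟙 (not (x <ᵇ p))                         ≡⟨ cong 𝟙 (allAbove-∷ p x<R) ⟩
      𝟙 (allAbove p (x ∷ R))                   ∎
      where
      open ≡-Reasoning
      i∉S : (i ∈ᵇ S) ≡ false
      i∉S = dec-false (i ∈ᵇ? S) λ i∈S → <⇒≱ m<i (All.lookup S≤m i∈S)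

    ∑Desc-first-letter k i p {x} {R} m≤i R↑@(x<R ∷ _) |R| =
      trans (∑Desc-suc k i p (x ∷ R) (λ _ → true) R↑ |R|)
            (trans (∑Next-cong i p (x ∷ R) λ a∈R → ∑Desc-ascending k (suc i) _ _ (s≤s m≤i) (Increasing-remove R↑)
                                                                  (length-remove-∈ R↑ a∈R |R|))
                   (∑Next-minimum i p x<R))

    ∑Desc-descent : ∀ k p R → Increasing R → length R ≡ k → ∑Desc k m p R (λ _ → true) ≡ 𝟙 (any (_<ᵇ p) R)
    ∑Desc-descent zero    p [] _ _
      rewrite all-false {P = _<ᵇ m} m∈S (<ᵇ-irrefl m) = refl
    ∑Desc-descent (suc k) p (x ∷ R) R↑@(x<R ∷ _) |R| = begin
      ∑Desc (suc k) m p (x ∷ R) (λ _ → true)  ≡⟨ ∑Desc-first-letter k m p ≤-refl R↑ |R| ⟩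
      𝟙 ((m ∈ᵇ S) ⇔ᵇ (x <ᵇ p))                 ≡⟨ cong (λ b → 𝟙 (b ⇔ᵇ (x <ᵇ p))) (dec-true (m ∈ᵇ? S) m∈S) ⟩
      𝟙 (true ⇔ᵇ (x <ᵇ p))                     ≡⟨ cong 𝟙 (⇔ᵇ-trueˡ (x <ᵇ p)) ⟩
      𝟙 (x <ᵇ p)                               ≡⟨ cong 𝟙 (any-<ᵇ-∷ p x<R) ⟩
      𝟙 (any (_<ᵇ p) (x ∷ R))                  ∎
      where open ≡-Reasoning

    ∑Desc≡∑Prefix : ∀ t k i p R M → i + t ≡ m → Increasing R → length R ≡ k + t →
                    ∑Desc (k + t) i p R (placedWithin M R t) ≡ ∑Prefix t i p R M
    ∑Desc≡∑Prefix zero k i p R M i+0≡m R↑ |R| rewrite +-identityʳ k | +-identityʳ i | i+0≡m =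
      trans (∑Desc-cong k m p R (λ w → all-cong M λ _ → ∨-identityʳ _)) (tail (noneLeft M R) |R|)
      where
      tail : ∀ b → length R ≡ k → ∑Desc k m p R (λ _ → b) ≡ 𝟙 (b ∧ any (_<ᵇ p) R)
      tail true  |R| = ∑Desc-descent k p R R↑ |R|
      tail false _   = trans (∑Arr-cong k R λ w _ → cong (λ b → if b then q ^ inv w else 0) (∧-zeroʳ _)) (∑Arr-zero k R)
    ∑Desc≡∑Prefix (suc t) k i p R M i+t≡m R↑ |R| rewrite +-suc k t =
      trans (∑Desc-suc (k + t) i p R (placedWithin M R (suc t)) R↑ |R|) (∑Next-cong i p R λ {a} a∈R →
        trans (∑Desc-cong (k + t) (suc i) a (remove a R) (placedWithin-∷ M R a t))
              (∑Desc≡∑Prefix t k (suc i) a (remove a R) M (trans (sym (+-suc i t)) i+t≡m)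
                              (Increasing-remove R↑) (length-remove-∈ R↑ a∈R |R|)))

  ∑Prefix-irrelevant : ∀ t i p R M {x} → x ∉ R → ∑Prefix t i p R (x ∷ M) ≡ ∑Prefix t i p R M
  ∑Prefix-irrelevant zero    i p R M {x} x∉R rewrite dec-false (x ∈ᵇ? R) x∉R = refl
  ∑Prefix-irrelevant (suc t) i p R M     x∉R =
    ∑Next-cong i p R λ _ → ∑Prefix-irrelevant t (suc i) _ _ M λ x∈R∖a → x∉R (proj₁ (∈-remove⁻ R x∈R∖a))

  ∑Prefix-short : ∀ t i p R M → Increasing R → length R ≤ t → ∑Prefix t i p R M ≡ 0
  ∑Prefix-short zero    i p []  M _  _     = cong 𝟙 (∧-zeroʳ (noneLeft M []))
  ∑Prefix-short (suc t) i p R M R↑ |R|≤1+t = ∑-vanishes R λ {a} a∈R →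
    nextTerm-vanishes i p R (λ a → ∑Prefix t (suc i) a (remove a R) M)
      (∑Prefix-short t (suc i) a (remove a R) M (Increasing-remove R↑)
      (≤-pred (subst (_≤ suc t) (length-remove R↑ a∈R) |R|≤1+t)))

  ∑Prefix-split-zero : ∀ i p R M {x} → x ∈ R → x ∉ M → (∀ {y} → y ∈ R → x < y → y ∈ M) →
    (x < p → 0 < count (_<ᵇ x) R) →
    ∑Prefix 0 i p R M ≡ q ^ count (x <ᵇ_) R * ∑Prefix 0 i p (remove x R) M + ∑Prefix 0 i p R (x ∷ M)
  ∑Prefix-split-zero i p R M {x} x∈R x∉M above-x∈M x<p⇒below = begin
    𝟙 (noneLeft M R ∧ any (_<ᵇ p) R)
      ≡⟨ by-cases (noneLeft M R) refl ⟩
    q ^ count (x <ᵇ_) R * 𝟙 (noneLeft M R ∧ any (_<ᵇ p) R)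
      ≡⟨ cong₂ (λ b b′ → q ^ count (x <ᵇ_) R * 𝟙 (b ∧ b′)) (sym noneLeft-remove) (sym any-remove-x) ⟩
    q ^ count (x <ᵇ_) R * ∑Prefix 0 i p (remove x R) M
      ≡⟨ sym (+-identityʳ _) ⟩
    q ^ count (x <ᵇ_) R * ∑Prefix 0 i p (remove x R) M + 𝟙 ((not true ∧ noneLeft M R) ∧ any (_<ᵇ p) R)
      ≡⟨ cong (λ b → q ^ count (x <ᵇ_) R * ∑Prefix 0 i p (remove x R) M + 𝟙 ((not b ∧ noneLeft M R) ∧ any (_<ᵇ p) R))
              (sym (dec-true (x ∈ᵇ? R) x∈R)) ⟩
    q ^ count (x <ᵇ_) R * ∑Prefix 0 i p (remove x R) M + ∑Prefix 0 i p R (x ∷ M) ∎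
    where
    open ≡-Reasoning
    noneLeft-remove : noneLeft M (remove x R) ≡ noneLeft M R
    noneLeft-remove = all-cong M λ {v} v∈M →
      cong not (trans (∈ᵇ-remove v x R) (trans (cong (λ b → (v ∈ᵇ R) ∧ not b) (dec-false (v ≟ x) λ { refl → x∉M v∈M }))
                                               (∧-identityʳ _)))
    any-remove-x : any (_<ᵇ p) (remove x R) ≡ any (_<ᵇ p) R
    any-remove-x with x <ᵇ p | <ᵇ-reflects-< x p
    ... | false | ofⁿ x≮p = any-remove (_<ᵇ p) R (dec-false (x <? p) x≮p)
    ... | true  | ofʸ x<p with y , y∈R , y<ᵇx ← count-positive (_<ᵇ x) R (x<p⇒below x<p) =
      trans (any-true (∈-remove⁺ y∈R (<⇒≢ y<x)) y<p) (sym (any-true y∈R y<p))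
      where
      y<x : y < x
      y<x = <ᵇ⇒< y x (subst T (sym y<ᵇx) tt)
      y<p : (y <ᵇ p) ≡ true
      y<p = dec-true (y <? p) (<-trans y<x x<p)
    nothing-above : noneLeft M R ≡ true → ∀ {y} → y ∈ R → (x <ᵇ y) ≡ false
    nothing-above none {y} y∈R = dec-false (x <? y) λ x<y →
      subst T (cong not (dec-true (y ∈ᵇ? R) y∈R)) (subst T (sym (all-sound none (above-x∈M y∈R x<y))) tt)
    by-cases : ∀ b → noneLeft M R ≡ b → 𝟙 (b ∧ any (_<ᵇ p) R) ≡ q ^ count (x <ᵇ_) R * 𝟙 (b ∧ any (_<ᵇ p) R)
    by-cases false _ = sym (*-zeroʳ (q ^ count (x <ᵇ_) R))
    by-cases true  none rewrite count-none (x <ᵇ_) R (nothing-above none) = sym (*-identityˡ _)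

  nextTerm-split : ∀ i p {R x a} (F G H : ℕ → ℕ) → Increasing R → x ∈ R → a ∈ R →
    F a ≡ q ^ count (x <ᵇ_) (remove a R) * G a + H a →
    nextTerm i p R F a ≡ q ^ count (x <ᵇ_) R * nextTerm i p (remove x R) G a + nextTerm i p R H a
  nextTerm-split i p {R} {x} {a} F G H R↑ x∈R a∈R Fa with (i ∈ᵇ S) ⇔ᵇ (a <ᵇ p)
  ... | false = sym (trans (+-identityʳ _) (*-zeroʳ (q ^ count (x <ᵇ_) R)))
  ... | true  = begin
    q ^ count (_<ᵇ a) R * F a
      ≡⟨ cong₂ (λ e n → q ^ e * n) below-a Fa ⟩
    q ^ (𝟙 (x <ᵇ a) + count (_<ᵇ a) (remove x R)) * (q ^ count (x <ᵇ_) (remove a R) * G a + H a)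
      ≡⟨ exchange (𝟙 (x <ᵇ a)) (count (_<ᵇ a) (remove x R)) (count (x <ᵇ_) (remove a R)) (G a) (H a) ⟩
    q ^ (𝟙 (x <ᵇ a) + count (x <ᵇ_) (remove a R)) * (q ^ count (_<ᵇ a) (remove x R) * G a)
      + q ^ (𝟙 (x <ᵇ a) + count (_<ᵇ a) (remove x R)) * H a
      ≡⟨ cong₂ (λ e e′ → q ^ e * (q ^ count (_<ᵇ a) (remove x R) * G a) + q ^ e′ * H a) (sym above-x) (sym below-a) ⟩
    q ^ count (x <ᵇ_) R * (q ^ count (_<ᵇ a) (remove x R) * G a) + q ^ count (_<ᵇ a) R * H a ∎
    where
    open ≡-Reasoning
    below-a : count (_<ᵇ a) R ≡ 𝟙 (x <ᵇ a) + count (_<ᵇ a) (remove x R)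
    below-a = ∑-remove (λ y → 𝟙 (y <ᵇ a)) R↑ x∈R
    above-x : count (x <ᵇ_) R ≡ 𝟙 (x <ᵇ a) + count (x <ᵇ_) (remove a R)
    above-x = ∑-remove (λ y → 𝟙 (x <ᵇ y)) R↑ a∈R
    exchange : ∀ d u v Z W → q ^ (d + u) * (q ^ v * Z + W) ≡ q ^ (d + v) * (q ^ u * Z) + q ^ (d + u) * W
    exchange d u v Z W rewrite ^-distribˡ-+-* q d u | ^-distribˡ-+-* q d v = ring (q ^ d) (q ^ u) (q ^ v) Z W
      where
      ring : ∀ D U V Z W → D * U * (V * Z + W) ≡ D * V * (U * Z) + D * U * W
      ring = solve-∀

  -- The bounds on count (_<ᵇ x) R leave enough letters below x in the tail that deleting x
  -- never decides whether the tail has a letter below the last chosen one.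
  ∑Prefix-split : ∀ t i p R M {x} → Increasing R → x ∈ R → x ∉ M → (∀ {y} → y ∈ R → x < y → y ∈ M) →
    t ≤ count (_<ᵇ x) R → (x < p → t < count (_<ᵇ x) R) →
    ∑Prefix t i p R M ≡ q ^ count (x <ᵇ_) R * ∑Prefix t i p (remove x R) M + ∑Prefix t i p R (x ∷ M)
  ∑Prefix-split zero    i p R M     R↑ x∈R x∉M above-x∈M _ x<p⇒below =
    ∑Prefix-split-zero i p R M x∈R x∉M above-x∈M x<p⇒below
  ∑Prefix-split (suc t) i p R M {x} R↑ x∈R x∉M above-x∈M 1+t≤below _ = begin
    ∑ (nextTerm i p R F) R
      ≡⟨ ∑-remove _ R↑ x∈R ⟩
    nextTerm i p R F x + ∑ (nextTerm i p R F) R∖x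
      ≡⟨ cong₂ _+_ (nextTerm-cong i p R F H (sym (∑Prefix-irrelevant t (suc i) x R∖x M x∉R∖x)))
                   (∑-cong R∖x split-term) ⟩
    nextTerm i p R H x + (∑[ a ∈ R∖x ] q ^ c * nextTerm i p R∖x G a + nextTerm i p R H a)
      ≡⟨ cong (nextTerm i p R H x +_)
              (trans (∑-distrib-+ _ _ R∖x) (cong (_+ ∑ (nextTerm i p R H) R∖x) (∑-*ˡ (q ^ c) _ R∖x))) ⟩
    nextTerm i p R H x + (q ^ c * ∑Next i p R∖x G + ∑ (nextTerm i p R H) R∖x)
      ≡⟨ x∙yz≈y∙xz (nextTerm i p R H x) (q ^ c * ∑Next i p R∖x G) _ ⟩
    q ^ c * ∑Next i p R∖x G + (nextTerm i p R H x + ∑ (nextTerm i p R H) R∖x)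
      ≡⟨ cong (q ^ c * ∑Next i p R∖x G +_) (sym (∑-remove _ R↑ x∈R)) ⟩
    q ^ c * ∑Next i p R∖x G + ∑Next i p R H ∎
    where
    open ≡-Reasoning
    R∖x : List ℕ
    R∖x = remove x R
    c : ℕ
    c = count (x <ᵇ_) R
    F G H : ℕ → ℕ
    F a = ∑Prefix t (suc i) a (remove a R) M
    G a = ∑Prefix t (suc i) a (remove a R∖x) M
    H a = ∑Prefix t (suc i) a (remove a R) (x ∷ M)
    x∉R∖x : x ∉ R∖x
    x∉R∖x x∈R∖x = proj₂ (∈-remove⁻ R x∈R∖x) refl
    split-term : ∀ {a} → a ∈ R∖x → nextTerm i p R F a ≡ q ^ c * nextTerm i p R∖x G a + nextTerm i p R H a
    split-term {a} a∈R∖x = nextTerm-split i p F G H R↑ x∈R a∈R (begin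
      F a   ≡⟨ ∑Prefix-split t (suc i) a (remove a R) M (Increasing-remove R↑) (∈-remove⁺ x∈R (a≢x ∘ sym)) x∉M
                 (λ y∈R∖a → above-x∈M (proj₁ (∈-remove⁻ R y∈R∖a))) (proj₁ bounds) (proj₂ bounds) ⟩
      q ^ count (x <ᵇ_) (remove a R) * ∑Prefix t (suc i) a (remove x (remove a R)) M + H a
            ≡⟨ cong (λ X → q ^ count (x <ᵇ_) (remove a R) * ∑Prefix t (suc i) a X M + H a) (remove-comm x a R) ⟩
      q ^ count (x <ᵇ_) (remove a R) * G a + H a ∎)
      where
      a∈R : a ∈ R
      a∈R = proj₁ (∈-remove⁻ R a∈R∖x)
      a≢x : a ≢ x
      a≢x = proj₂ (∈-remove⁻ R a∈R∖x)
      bounds : t ≤ count (_<ᵇ x) (remove a R) × (x < a → t < count (_<ᵇ x) (remove a R))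
      bounds with a <ᵇ x | <ᵇ-reflects-< a x | ∑-remove (λ y → 𝟙 (y <ᵇ x)) R↑ a∈R
      ... | true  | ofʸ a<x | below≡ = ≤-pred (subst (suc t ≤_) below≡ 1+t≤below) , λ x<a → ⊥-elim (<-asym a<x x<a)
      ... | false | _       | below≡ = let 1+t≤ = subst (suc t ≤_) below≡ 1+t≤below in <⇒≤ 1+t≤ , λ _ → 1+t≤

  ∑Prefix-relabel : ∀ (φ : ℕ → ℕ) → (∀ {x y} → x < y → φ x < φ y) →
                    ∀ t i p R M → ∑Prefix t i (φ p) (map φ R) (map φ M) ≡ ∑Prefix t i p R M
  ∑Prefix-relabel φ φ-mono = relabel
    where
    open StrictlyMonotone φ φ-mono
    relabel : ∀ t i p R M → ∑Prefix t i (φ p) (map φ R) (map φ M) ≡ ∑Prefix t i p R M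
    relabel zero i p R M = cong 𝟙 (cong₂ _∧_
      (trans (cong and (sym (map-∘ M))) (all-cong M λ {v} _ → cong not (∈ᵇ-map v R)))
      (trans (cong or (sym (map-∘ R))) (any-cong R λ {y} _ → φ-<ᵇ y p)))
    relabel (suc t) i p R M = trans (∑-map _ φ R) (∑-cong R λ {a} _ → relabel-term a)
      where
      relabel-term : ∀ a → nextTerm i (φ p) (map φ R) (λ b → ∑Prefix t (suc i) b (remove b (map φ R)) (map φ M)) (φ a)
                           ≡ nextTerm i p R (λ b → ∑Prefix t (suc i) b (remove b R) M) a
      relabel-term a rewrite φ-<ᵇ a p | remove-map a R | relabel t (suc i) a (remove a R) M
                           | ∑-map (λ y → 𝟙 (y <ᵇ φ a)) φ R | ∑-cong R (λ {y} _ → cong 𝟙 (φ-<ᵇ y a)) = refl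

  module TopValues (m : ℕ) where

    Dtop : ℕ → ℕ → ℕ
    Dtop L k = ∑Prefix m 0 0 (segment 1 (L + k)) (segment (suc L) k)

    Dtop-pascal : ∀ L k → m ≤ L → Dtop (suc L) k ≡ q ^ k * Dtop L k + Dtop L (suc k)
    Dtop-pascal L k m≤L = begin
      Dtop (suc L) k
        ≡⟨ cong (λ n → ∑Prefix m 0 0 (segment 1 n) high) (sym (+-suc L k)) ⟩
      ∑Prefix m 0 0 R high
        ≡⟨ ∑Prefix-split m 0 0 R high (segment-increasing 1 (L + suc k)) (middle-∈ L k) (middle-∉-high L k)
                         (above-middle-∈ L k) (subst (m ≤_) (sym (count-below-middle L k)) m≤L) (λ ()) ⟩
      q ^ count (suc L <ᵇ_) R * ∑Prefix m 0 0 (remove (suc L) R) high + Dtop L (suc k)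
        ≡⟨ cong₂ (λ c R′ → q ^ c * ∑Prefix m 0 0 R′ high + Dtop L (suc k)) (count-above-middle L k) (remove-middle L k) ⟩
      q ^ k * ∑Prefix m 0 0 (map (skip L) (segment 1 (L + k))) high + Dtop L (suc k)
        ≡⟨ cong (λ M → q ^ k * ∑Prefix m 0 0 (map (skip L) (segment 1 (L + k))) M + Dtop L (suc k))
                (sym (map-skip-high L k)) ⟩
      q ^ k * ∑Prefix m 0 (skip L 0) (map (skip L) (segment 1 (L + k))) (map (skip L) (segment (suc L) k)) + Dtop L (suc k)
        ≡⟨ cong (λ n → q ^ k * n + Dtop L (suc k))
                (∑Prefix-relabel (skip L) (skip-mono L) m 0 0 (segment 1 (L + k)) (segment (suc L) k)) ⟩
      q ^ k * Dtop L k + Dtop L (suc k) ∎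
      where
      open ≡-Reasoning
      R high : List ℕ
      R    = segment 1 (L + suc k)
      high = segment (2 + L) k

maxL-upper : ∀ S → All (_≤ maxL S) S
maxL-upper []      = []
maxL-upper (s ∷ S) = m≤m⊔n s (maxL S) ∷ All.map (λ t≤max → ≤-trans t≤max (m≤n⊔m s (maxL S))) (maxL-upper S)

maxL-∈ : ∀ S → S ≢ [] → maxL S ∈ S
maxL-∈ []           S≢[] = ⊥-elim (S≢[] refl)
maxL-∈ (s ∷ [])     _    = here (⊔-identityʳ s)
maxL-∈ (s ∷ s′ ∷ S) _    with ⊔-sel s (maxL (s′ ∷ S)) | maxL-∈ (s′ ∷ S) (λ ())
... | inj₁ max≡s | _       = here max≡s
... | inj₂ max≡m | max′∈S = there (subst (_∈ s′ ∷ S) (sym max≡m) max′∈S)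

module Expansion (S : List ℕ) (S≢[] : S ≢ []) (1≤S : All (1 ≤_) S) (q : ℕ) where

  m : ℕ
  m = maxL S

  open PrefixSums S q
  open TopValues m
  open QBinomial q

  private
    R↑ : ∀ n → Increasing (segment 1 n)
    R↑ = segment-increasing 1

  D≡Dtop : ∀ N → D S (m + N) q ≡ Dtop (m + N) 0
  D≡Dtop N = begin
    D S n q
      ≡⟨ ∑-perms n _ ⟩
    ∑Arr n R (λ π → if DesEqᵇ π S then q ^ inv π else 0)
      ≡⟨ ∑Arr-cong n R (λ w _ → cong (λ b → if b then q ^ inv w else 0)
                                      (trans (DesEqᵇ≡hasDescents S 1≤S w) (sym (∧-identityʳ _)))) ⟩
    ∑Desc n 0 0 R (placedWithin [] R m)
      ≡⟨ cong (λ k → ∑Desc k 0 0 R (placedWithin [] R m)) (+-comm m N) ⟩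
    ∑Desc (N + m) 0 0 R (placedWithin [] R m)
      ≡⟨ ∑Desc≡∑Prefix (maxL-∈ S S≢[]) (maxL-upper S) m N 0 0 R [] refl (R↑ n)
                        (trans (length-segment 1 n) (+-comm m N)) ⟩
    ∑Prefix m 0 0 R []
      ≡⟨ cong (λ L → ∑Prefix m 0 0 (segment 1 L) []) (sym (+-identityʳ n)) ⟩
    Dtop (m + N) 0 ∎
    where
    open ≡-Reasoning
    n : ℕ
    n = m + N
    R : List ℕ
    R = segment 1 n

  a≡Dtop : ∀ k → a S k q ≡ Dtop m k
  a≡Dtop zero    =
    sym (∑Prefix-short m 0 0 _ [] (R↑ (m + 0)) (≤-reflexive (trans (length-segment 1 (m + 0)) (+-identityʳ m))))
  a≡Dtop (suc j) = begin
    a S (suc j) q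
      ≡⟨ ∑-perms n _ ⟩
    ∑Arr n R (λ π → if DesEqᵇ π S ∧ all (_∈ᵇ take m π) (interval (suc m) n) then q ^ inv π else 0)
      ≡⟨ ∑Arr-cong n R (λ w _ → cong (λ b → if b then q ^ inv w else 0)
                                      (cong₂ _∧_ (DesEqᵇ≡hasDescents S 1≤S w) (placed-in-head w))) ⟩
    ∑Desc n 0 0 R (placedWithin M R m)
      ≡⟨ cong (λ k → ∑Desc k 0 0 R (placedWithin M R m)) (+-comm m (suc j)) ⟩
    ∑Desc (suc j + m) 0 0 R (placedWithin M R m)
      ≡⟨ ∑Desc≡∑Prefix (maxL-∈ S S≢[]) (maxL-upper S) m (suc j) 0 0 R M refl (R↑ n)
                        (trans (length-segment 1 n) (+-comm m (suc j))) ⟩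
    Dtop m (suc j) ∎
    where
    open ≡-Reasoning
    n : ℕ
    n = m + suc j
    R M : List ℕ
    R = segment 1 n
    M = segment (suc m) (suc j)
    M⊆R : ∀ {v} → v ∈ M → v ∈ R
    M⊆R v∈M = ∈-segment (≤-trans (s≤s z≤n) (All.lookup (segment-lower (suc m) (suc j)) v∈M))
                        (All.lookup (segment-upper (suc m) (suc j)) v∈M)
    placed-in-head : ∀ w → all (_∈ᵇ take m w) (interval (suc m) n) ≡ placedWithin M R m w
    placed-in-head w rewrite interval≡segment (suc m) n | m+n∸m≡n m (suc j) =
      all-cong M λ {v} v∈M → cong (λ b → not b ∨ (v ∈ᵇ take m w)) (sym (dec-true (v ∈ᵇ? R) (M⊆R v∈M)))

  a-vanishes : ∀ k → m < k → a S k q ≡ 0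
  a-vanishes (suc j) m<1+j = ∑-vanishes (perms (m + suc j)) λ {π} _ → cong (λ b → if b then q ^ inv π else 0) (begin
    DesEqᵇ π S ∧ all (_∈ᵇ take m π) (interval (suc m) (m + suc j))
      ≡⟨ cong (λ B → DesEqᵇ π S ∧ all (_∈ᵇ take m π) B)
              (trans (interval≡segment (suc m) (m + suc j)) (cong (segment (suc m)) (m+n∸m≡n m (suc j)))) ⟩
    DesEqᵇ π S ∧ all (_∈ᵇ take m π) (segment (suc m) (suc j))
      ≡⟨ cong (DesEqᵇ π S ∧_) (covers-too-short (take m π) (segment-increasing (suc m) (suc j)) (|head|< π)) ⟩
    DesEqᵇ π S ∧ false
      ≡⟨ ∧-zeroʳ _ ⟩
    false ∎)
    where
    open ≡-Reasoning
    |head|< : ∀ π → length (take m π) < length (segment (suc m) (suc j))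
    |head|< π = ≤-<-trans (≤-trans (≤-reflexive (length-take m π)) (m⊓n≤m m _))
                        (subst (m <_) (sym (length-segment (suc m) (suc j))) m<1+j)

  D-expansion : ∀ N → D S (m + N) q ≡ ∑[ k < suc m ] a S k q * qbinom q N k
  D-expansion N = begin
    D S (m + N) q
      ≡⟨ D≡Dtop N ⟩
    Dtop (m + N) 0
      ≡⟨ expansion-qChoose N (suc m + N) (s≤s (m≤n+m N m)) ⟩
    ∑[ k < suc m + N ] Dtop (m + 0) k * qChoose N k
      ≡⟨ ∑<-cong (suc m + N) (λ k → cong₂ _*_ (trans (cong (λ L → Dtop L k) (+-identityʳ m)) (sym (a≡Dtop k)))
                                                 (qChoose≡qbinom N k)) ⟩
    ∑< (suc m + N) term
      ≡⟨ ∑<-+ (suc m) N term ⟩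
    ∑< (suc m) term + (∑[ k < N ] term (suc m + k))
      ≡⟨ cong (∑< (suc m) term +_)
              (∑<-vanishes N λ k → cong (_* qbinom q N (suc m + k)) (a-vanishes (suc m + k) (s≤s (m≤m+n m k)))) ⟩
    ∑< (suc m) term + 0
      ≡⟨ +-identityʳ _ ⟩
    ∑< (suc m) term ∎
    where
    open ≡-Reasoning
    open PascalExpansion (λ u k → Dtop (m + u) k)
                         (λ u k → trans (cong (λ L → Dtop L k) (+-suc m u)) (Dtop-pascal (m + u) k (m≤m+n m u)))
    term : ℕ → ℕ
    term k = a S k q * qbinom q N k

theorem2p1 : (S : List ℕ) → S ≢ [] → All (λ s → 1 ≤ s) S →
    (n : ℕ) → maxL S ≤ n → (q : ℕ) →
    D S n q ≡ sum (map (λ k → a S k q * qbinom q (n ∸ maxL S) k) (upTo (maxL S + 1)))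
theorem2p1 S S≢[] 1≤S n m≤n q = begin
  D S n q
    ≡⟨ cong (λ n → D S n q) (sym (m+[n∸m]≡n m≤n)) ⟩
  D S (m + N) q
    ≡⟨ D-expansion N ⟩
  ∑[ k < suc m ] a S k q * qbinom q N k
    ≡⟨ sym (∑-upTo (suc m) (λ k → a S k q * qbinom q N k)) ⟩
  ∑[ k ∈ upTo (suc m) ] a S k q * qbinom q N k
    ≡⟨ cong (λ L → ∑[ k ∈ upTo L ] a S k q * qbinom q N k) (+-comm 1 m) ⟩
  sum (map (λ k → a S k q * qbinom q N k) (upTo (m + 1))) ∎
  where
  open ≡-Reasoning
  open Expansion S S≢[] 1≤S q
  N : ℕ
  N = n ∸ m
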